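{- Let $(\Gamma,\lambda)$ be a tree plan and $S$ a countably infinite set. Then the $\mathcal{L}_\Gamma$-structure $\Gamma(S)$ is ultrahomogeneous, and its theory $\mathrm{Th}(\Gamma(S))$ is $\aleph_0$-categorical.
   Context: A tree plan is a pair $(\Gamma,\lambda)$ where $\Gamma$ is a finite subset of $\omega^{<\omega}$ containing the empty sequence $\langle\rangle$ and closed under initial segments, and $\lambda:\Gamma\to\{1,\infty\}$ with $\lambda(\langle\rangle)=1$. $\Gamma(S)$ is the set of finite sequences $\langle (i_0,t_0),\dots,(i_n,t_n)\rangle$ (including the empty sequence) such that $\langle i_0,\dots,i_n\rangle\in\Gamma$ and for each $k\le n$, $t_k=\star$ (a fixed symbol not in $S$) if $\lambda(\langle i_0,\dots,i_k\rangle)=1$, and $t_k\in S$ if $\lambda(\langle i_0,\dots,i_k\rangle)=\infty$; $\pi(\langle (i_0,t_0),\dots,(i_n,t_n)\rangle)=\langle i_0,\dots,i_n\rangle$. The language $\mathcal{L}_\Gamma$ consists of a binary relation $\le$ (interpreted as the initial-segment order), a constant $\varepsilon$ (the empty sequence), a binary function $\sqcap$ (longest common initial segment), a unary function $\mathtt{pred}$ (delete the last entry; $\mathtt{pred}(\varepsilon)=\varepsilon$), and unary predicates $P_\sigma$ for $\sigma\in\Gamma$, interpreted as $\pi^{ -1}(\sigma)$. -}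

module Defs where

open import Data.Nat using (ℕ)
open import Data.Nat.Properties using () renaming (_≟_ to _≟ℕ_)
open import Data.Bool using (T)
open import Data.Fin using (Fin; zero; suc)
open import Data.List using (List; []; _∷_; _++_; _∷ʳ_; map; length; lookup)
open import Data.List.Properties using () renaming (≡-dec to List-≡-dec)
open import Data.List.Membership.Propositional using (_∈_)
open import Data.List.Relation.Unary.Unique.Propositional using (Unique)
import Data.List.Membership.DecPropositional as DecMem
open import Data.Maybe using (Maybe; just; nothing)
open import Data.Maybe.Properties using () renaming (≡-dec to Maybe-≡-dec)
open import Data.Product using (Σ; ∃; _×_; _,_; proj₁; proj₂)
open import Data.Product.Properties using () renaming (≡-dec to Σ-≡-dec)
open import Data.Unit using (⊤; tt)
open import Data.Empty using (⊥)
open import Data.Sum using (_⊎_)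
open import Function.Bundles using (_↔_; _⇔_; Inverse)
open import Relation.Nullary using (Dec; yes; no; does; ¬_)
open import Relation.Binary.Definitions using (DecidableEquality)
open import Relation.Binary.PropositionalEquality using (_≡_; refl; sym; trans; cong)

data Lab : Set where
  one inf : Lab

_≟ₗ_ : DecidableEquality (List ℕ)
_≟ₗ_ = List-≡-dec _≟ℕ_

-- A tree plan (Γ , λ).  Γ is a finite subset of ω^{<ω}, given as a
-- duplicate-free list of finite sequences of naturals; λ is given as a
-- total function on ω^{<ω} (only its values on Γ matter).
record TreePlan : Set where
  field
    Γ        : List (List ℕ)
    Γ-unique : Unique Γ
    Γ-root   : [] ∈ Γ
    Γ-closed : ∀ (σ τ : List ℕ) → (σ ++ τ) ∈ Γ → σ ∈ Γ
    lab      : List ℕ → Lab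
    lab-root : lab [] ≡ one

-- L_Γ-structures.  The predicate symbols P_σ (σ ∈ Γ) are indexed by
-- positions k : Fin (length Γ), with σ = lookup Γ k.

record Structure (TP : TreePlan) : Set₁ where
  open TreePlan TP
  field
    Carrier : Set
    _≤_     : Carrier → Carrier → Set
    ε       : Carrier
    _⊓_     : Carrier → Carrier → Carrier
    pred    : Carrier → Carrier
    P       : Fin (length Γ) → Carrier → Set

module GammaS (TP : TreePlan) (S : Set) (_≟S_ : DecidableEquality S) where
  open TreePlan TP
  open DecMem _≟ₗ_ using (_∈?_)

  -- ⋆ is represented by nothing, an element s ∈ S by just s
  Seq : Set
  Seq = List (ℕ × Maybe S)

  π : Seq → List ℕ
  π = map proj₁

  Match : Lab → Maybe S → Set
  Match one nothing  = ⊤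
  Match one (just _) = ⊥
  Match inf nothing  = ⊥
  Match inf (just _) = ⊤

  Valid : List ℕ → Seq → Set
  Valid pre []             = ⊤
  Valid pre ((i , t) ∷ xs) =
    T (does ((pre ∷ʳ i) ∈? Γ)) × Match (lab (pre ∷ʳ i)) t × Valid (pre ∷ʳ i) xs

  Elem : Set
  Elem = Σ Seq (Valid [])

  _≟e_ : DecidableEquality (ℕ × Maybe S)
  _≟e_ = Σ-≡-dec _≟ℕ_ (Maybe-≡-dec _≟S_)

  lcp : Seq → Seq → Seq
  lcp []       _        = []
  lcp (_ ∷ _)  []       = []
  lcp (a ∷ xs) (b ∷ ys) with a ≟e b
  ... | yes _ = a ∷ lcp xs ys
  ... | no  _ = []

  lcp-valid : ∀ pre xs ys → Valid pre xs → Valid pre (lcp xs ys)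
  lcp-valid pre []       _        v = tt
  lcp-valid pre (_ ∷ _)  []       v = tt
  lcp-valid pre ((i , t) ∷ xs) (b ∷ ys) (p , m , v) with (i , t) ≟e b
  ... | yes _ = p , m , lcp-valid (pre ∷ʳ i) xs ys v
  ... | no  _ = tt

  dropLast : Seq → Seq
  dropLast []           = []
  dropLast (_ ∷ [])     = []
  dropLast (x ∷ y ∷ xs) = x ∷ dropLast (y ∷ xs)

  dropLast-valid : ∀ pre xs → Valid pre xs → Valid pre (dropLast xs)
  dropLast-valid pre []                 v = tt
  dropLast-valid pre (_ ∷ [])           v = tt
  dropLast-valid pre ((i , t) ∷ y ∷ xs) (p , m , v) =
    p , m , dropLast-valid (pre ∷ʳ i) (y ∷ xs) v

  _≼_ : Seq → Seq → Set
  xs ≼ ys = ∃ λ zs → xs ++ zs ≡ ys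

  structure : Structure TP
  structure = record
    { Carrier = Elem
    ; _≤_     = λ x y → proj₁ x ≼ proj₁ y
    ; ε       = [] , tt
    ; _⊓_     = λ x y → lcp (proj₁ x) (proj₁ y) , lcp-valid [] (proj₁ x) (proj₁ y) (proj₂ x)
    ; pred    = λ x → dropLast (proj₁ x) , dropLast-valid [] (proj₁ x) (proj₂ x)
    ; P       = λ k x → π (proj₁ x) ≡ lookup Γ k
    }

decEq-from-↔ℕ : {S : Set} → S ↔ ℕ → DecidableEquality S
decEq-from-↔ℕ e x y with Inverse.to e x ≟ℕ Inverse.to e y
... | yes p = yes (trans (sym (Inverse.inverseʳ e refl))
                        (trans (cong (Inverse.from e) p) (Inverse.inverseʳ e refl)))
... | no ¬p = no (λ q → ¬p (cong (Inverse.to e) q))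

Γ⟨_⟩ : (TP : TreePlan) {S : Set} → S ↔ ℕ → Structure TP
Γ⟨ TP ⟩ {S} e = GammaS.structure TP S (decEq-from-↔ℕ e)

module _ (TP : TreePlan) where
  open TreePlan TP

  data Term (n : ℕ) : Set where
    var  : Fin n → Term n
    ε'   : Term n
    meet : Term n → Term n → Term n
    pred' : Term n → Term n

  data Formula : ℕ → Set where
    _≐_  : ∀ {n} → Term n → Term n → Formula n
    _≤'_ : ∀ {n} → Term n → Term n → Formula n
    P'   : ∀ {n} → Fin (length Γ) → Term n → Formula n
    ⊥'   : ∀ {n} → Formula n
    _∧'_ _∨'_ _⇒'_ : ∀ {n} → Formula n → Formula n → Formula n
    ¬'_  : ∀ {n} → Formula n → Formula n
    ∀'_ ∃'_ : ∀ {n} → Formula (ℕ.suc n) → Formula n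

  Sentence : Set
  Sentence = Formula 0

module _ {TP : TreePlan} (M : Structure TP) where
  open Structure M

  extend : ∀ {n} → Carrier → (Fin n → Carrier) → Fin (ℕ.suc n) → Carrier
  extend x ρ zero    = x
  extend x ρ (suc i) = ρ i

  eval : ∀ {n} → (Fin n → Carrier) → Term TP n → Carrier
  eval ρ (var i)    = ρ i
  eval ρ ε'         = ε
  eval ρ (meet t s) = eval ρ t ⊓ eval ρ s
  eval ρ (pred' t)  = pred (eval ρ t)

  Sat : ∀ {n} → (Fin n → Carrier) → Formula TP n → Set
  Sat ρ (t ≐ s)   = eval ρ t ≡ eval ρ s
  Sat ρ (t ≤' s)  = eval ρ t ≤ eval ρ s
  Sat ρ (P' k t)  = P k (eval ρ t)
  Sat ρ ⊥'        = ⊥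
  Sat ρ (φ ∧' ψ)  = Sat ρ φ × Sat ρ ψ
  Sat ρ (φ ∨' ψ)  = Sat ρ φ ⊎ Sat ρ ψ
  Sat ρ (φ ⇒' ψ)  = Sat ρ φ → Sat ρ ψ
  Sat ρ (¬' φ)    = ¬ Sat ρ φ
  Sat ρ (∀' φ)    = (x : Carrier) → Sat (extend x ρ) φ
  Sat ρ (∃' φ)    = Σ Carrier λ x → Sat (extend x ρ) φ

  _⊨_ : Sentence TP → Set
  _⊨_ φ = Sat (λ ()) φ

record Iso {TP : TreePlan} (M N : Structure TP) : Set where
  private
    module M = Structure M
    module N = Structure N
  field
    bij     : M.Carrier ↔ N.Carrier
  f : M.Carrier → N.Carrier
  f = Inverse.to bij
  field
    pres-ε    : f M.ε ≡ N.ε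
    pres-⊓    : ∀ x y → f (x M.⊓ y) ≡ f x N.⊓ f y
    pres-pred : ∀ x → f (M.pred x) ≡ N.pred (f x)
    pres-≤    : ∀ x y → (x M.≤ y) ⇔ (f x N.≤ f y)
    pres-P    : ∀ k x → M.P k x ⇔ N.P k (f x)

ModelOfTh : {TP : TreePlan} → Structure TP → Structure TP → Set
ModelOfTh M N = ∀ φ → N ⊨ φ → M ⊨ φ

ℵ₀-categoricalTh : {TP : TreePlan} → Structure TP → Set₁
ℵ₀-categoricalTh {TP} N =
  (M₁ M₂ : Structure TP) →
  Structure.Carrier M₁ ↔ ℕ → Structure.Carrier M₂ ↔ ℕ →
  ModelOfTh M₁ N → ModelOfTh M₂ N → Iso M₁ M₂

module _ {TP : TreePlan} (M : Structure TP) where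
  open Structure M

  Gen : ∀ {n} → (Fin n → Carrier) → Carrier → Set
  Gen {n} a x = Σ (Term TP n) λ t → eval M a t ≡ x

  -- Since
  -- membership proofs may be non-unique, f is required to be independent
  -- of them (this is part of wd-inj).
  record SubIso (A B : Carrier → Set) : Set where
    field
      fun       : (x : Carrier) → A x → Carrier
      into      : ∀ x p → B (fun x p)
      wd-inj    : ∀ x y p q → (fun x p ≡ fun y q) ⇔ (x ≡ y)
      onto      : ∀ y → B y → Σ Carrier λ x → Σ (A x) λ p → fun x p ≡ y
      pres-ε    : ∀ p → fun ε p ≡ ε
      pres-⊓    : ∀ x y p q r → fun (x ⊓ y) r ≡ fun x p ⊓ fun y q
      pres-pred : ∀ x p r → fun (pred x) r ≡ pred (fun x p)
      pres-≤    : ∀ x y p q → (x ≤ y) ⇔ (fun x p ≤ fun y q)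
      pres-P    : ∀ k x p → P k x ⇔ P k (fun x p)

  Ultrahomogeneous : Set
  Ultrahomogeneous =
    ∀ {n m} (a : Fin n → Carrier) (b : Fin m → Carrier) →
    (h : SubIso (Gen a) (Gen b)) →
    Σ (Iso M M) λ g → ∀ x p → Iso.f g x ≡ SubIso.fun h x p

-- Both parts rest on one reconstruction principle. Let M satisfy the elementary tree axioms of Γ(S)
-- (every element has exactly one sort, ε is the only root, pred goes to the parent sort, ≤ is a bounded
-- iterate of pred, ⊓ is the meet). Suppose that, for every element m and every admissible step (i , t),
-- we choose a child of m of sort π(m) i so that t ↦ child is a bijection from the admissible labels
-- onto these children. Then following the chosen children along a sequence is an isomorphism Γ(S) ≅ M.
--
-- In a countable model of Th(Γ(S)) such a choice exists: first-order axioms say that an element has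
-- exactly one child of each child sort labelled 1 and infinitely many of each child sort labelled ∞,
-- and the latter are matched with S ≅ ℕ by enumerating them in increasing order of their codes. So all
-- countable models are isomorphic to Γ(S). For ultrahomogeneity, a finitely generated substructure A consists of
-- ancestors of the generators, so an isomorphism h : A ≅ B induces, below each node and in each
-- direction, a finite partial injection of labels in S. Extending each to a permutation of S by
-- transpositions gives a child choice on Γ(S) itself whose isomorphism is an automorphism extending h.
-- Excluded middle decides the relevant properties of the models.

module Submission where

open import Defs
open import Data.Nat using (ℕ; zero; suc; _+_; _∸_; _≤_; _<_; z≤n; s≤s)
open import Data.Nat.Properties
  using (+-identityʳ; +-suc; +-comm; m+[n∸m]≡n; ≤-refl; ≤-reflexive; ≤-trans; n≤1+n; m≤n+m; m≤m+n;
         <-trans; <⇒≱; <-cmp; m≤n⇒m<n∨m≡n; ≮⇒≥; ≤-totalOrder; module ≤-Reasoning)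
open import Data.Nat.GeneralisedArithmetic using (iterate)
open import Data.Bool using (T)
open import Data.Bool.Properties using (T-irrelevant)
open import Data.Product using (Σ; ∃; _×_; _,_; proj₁; proj₂)
open import Data.Sum using (_⊎_; inj₁; inj₂)
open import Data.Unit using (tt)
open import Data.Empty using (⊥-elim)
open import Data.Maybe as Maybe using (Maybe; just; nothing)
open import Data.Maybe.Properties using (just-injective; map-injective; map-∘; map-cong; map-id)
open import Data.List using (List; []; _∷_; _++_; _∷ʳ_; map; length; lookup; mapMaybe; allFin; upTo; cartesianProductWith)
open import Data.List.Properties
  using (∷ʳ-injective; ∷ʳ-injectiveʳ; ∷ʳ-++; ++-identityʳ; ++-assoc; ++-conicalˡ; ++-identityʳ-unique;
         map-++; length-map; length-++)
open import Data.List.Reverse using (Reverse; reverseView; []; _∶_∶ʳ_)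
open import Data.List.Extrema (≤-totalOrder) using (max; xs≤max)
open import Data.List.Membership.Propositional using (_∈_)
open import Data.List.Membership.Propositional.Properties
  using (∈-lookup; ∈-map⁺; ∈-cartesianProductWith⁺; ∈-allFin; ∈-upTo⁺)
open import Data.List.Relation.Unary.All as All using (All)
open import Data.List.Relation.Unary.AllPairs using (_∷_)
open import Data.List.Relation.Unary.Any using (here; there; index)
open import Data.List.Relation.Unary.Any.Properties using (lookup-index)
open import Data.List.Relation.Unary.Unique.Propositional using (Unique)
import Data.List.Membership.DecPropositional as DecMembership
open import Data.Fin using (Fin; zero; suc; _↑ˡ_; _↑ʳ_; toℕ; fromℕ<) renaming (_≟_ to _≟ᶠ_)
open import Data.Fin.Properties using (toℕ-fromℕ<; toℕ≤pred[n])
open import Function.Base using (_∘_; id; case_of_)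
open import Level using (0ℓ)
open import Axiom.ExcludedMiddle using (ExcludedMiddle)
open import Function.Bundles using (_↔_; _⇔_; Inverse; Injection; Equivalence; mk↔ₛ′; mk⇔)
open import Function.Properties.Inverse using (↔-refl; ↔-sym; ↔-trans; ↔⇒↣)
open import Function.Properties.Equivalence using () renaming (trans to ⇔-trans)
open import Relation.Nullary using (Dec; yes; no; does; ¬_)
open import Relation.Unary using (Decidable)
open import Relation.Binary.Definitions using (DecidableEquality; tri<; tri≈; tri>)
open import Relation.Binary.PropositionalEquality

T-does⇒ : {A : Set} (d : Dec A) → T (does d) → A
T-does⇒ (yes a) _ = a

⇒T-does : {A : Set} (d : Dec A) → A → T (does d)
⇒T-does (yes _) _ = tt
⇒T-does (no ¬a) a = ¬a a

lookup-injective : {A : Set} {xs : List A} → Unique xs → ∀ {k l} → lookup xs k ≡ lookup xs l → k ≡ l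
lookup-injective (_ ∷ _)        {zero}  {zero}  _  = refl
lookup-injective (x∉xs ∷ _)     {zero}  {suc l} eq = ⊥-elim (All.lookup x∉xs (∈-lookup l) eq)
lookup-injective (x∉xs ∷ _)     {suc k} {zero}  eq = ⊥-elim (All.lookup x∉xs (∈-lookup k) (sym eq))
lookup-injective (_ ∷ unique)   {suc k} {suc l} eq = cong suc (lookup-injective unique eq)

iterate-commute : {A B : Set} {f : A → A} {g : B → B} (h : A → B) → (∀ x → h (f x) ≡ g (h x)) →
                  ∀ x n → h (iterate f x n) ≡ iterate g (h x) n
iterate-commute h comm x zero    = refl
iterate-commute {g = g} h comm x (suc n) = trans (iterate-commute h comm _ n) (cong (λ y → iterate g y n) (comm x))

∷ʳ≢[] : {A : Set} (xs : List A) {a : A} → xs ∷ʳ a ≢ []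
∷ʳ≢[] []      ()
∷ʳ≢[] (_ ∷ _) ()

∈-mapMaybe⁺ : {A B : Set} (f : A → Maybe B) {xs : List A} {x : A} {y : B} →
              x ∈ xs → f x ≡ just y → y ∈ mapMaybe f xs
∈-mapMaybe⁺ f {x ∷ _}  (here refl) fx≡ rewrite fx≡ = here refl
∈-mapMaybe⁺ f {x′ ∷ _} (there x∈) fx≡ with f x′
... | just _  = there (∈-mapMaybe⁺ f x∈ fx≡)
... | nothing = ∈-mapMaybe⁺ f x∈ fx≡

∈-mapMaybe⁻ : {A B : Set} (f : A → Maybe B) (xs : List A) {y : B} →
              y ∈ mapMaybe f xs → ∃ λ x → x ∈ xs × f x ≡ just y
∈-mapMaybe⁻ f (x ∷ xs) y∈ with f x in fx≡
... | nothing = let x′ , x′∈ , eq = ∈-mapMaybe⁻ f xs y∈ in x′ , there x′∈ , eq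
... | just _ with y∈
...   | here refl = x , here refl , fx≡
...   | there y∈′ = let x′ , x′∈ , eq = ∈-mapMaybe⁻ f xs y∈′ in x′ , there x′∈ , eq

module Enumeration {U : ℕ → Set} (U? : Decidable U)
                   (unbounded : ∀ b → ∃ λ n → b ≤ n × U n) where

  record LeastFrom (b n : ℕ) : Set where
    field
      member : U n
      above  : b ≤ n
      least  : ∀ {k} → b ≤ k → k < n → ¬ U k

  search : ℕ → ℕ → ℕ
  search b zero    = b
  search b (suc d) with U? b
  ... | yes _ = b
  ... | no  _ = search (suc b) d

  search-least : ∀ b d → U (b + d) → LeastFrom b (search b d)
  search-least b zero u =
    record { member = subst U (+-identityʳ b) u ; above = ≤-refl ; least = λ b≤k k<b → ⊥-elim (<⇒≱ k<b b≤k) }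
  search-least b (suc d) u with U? b
  ... | yes ub = record { member = ub ; above = ≤-refl ; least = λ b≤k k<b → ⊥-elim (<⇒≱ k<b b≤k) }
  ... | no ¬ub = record { member = member ; above = ≤-trans (n≤1+n b) above ; least = least-from-b }
    where
    open LeastFrom (search-least (suc b) d (subst U (+-suc b d) u))
    least-from-b : ∀ {k} → b ≤ k → k < search (suc b) d → ¬ U k
    least-from-b b≤k k<n with m≤n⇒m<n∨m≡n b≤k
    ... | inj₁ b<k  = least b<k k<n
    ... | inj₂ refl = ¬ub

  next : ℕ → ℕ
  next b = search b (proj₁ (unbounded b) ∸ b)

  next-least : ∀ b → LeastFrom b (next b)
  next-least b with unbounded b
  ... | n , b≤n , un = search-least b (n ∸ b) (subst U (sym (m+[n∸m]≡n b≤n)) un)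

  enum : ℕ → ℕ
  enum zero    = next 0
  enum (suc k) = next (suc (enum k))

  enum-∈ : ∀ k → U (enum k)
  enum-∈ zero    = LeastFrom.member (next-least 0)
  enum-∈ (suc k) = LeastFrom.member (next-least (suc (enum k)))

  enum-step : ∀ k → enum k < enum (suc k)
  enum-step k = LeastFrom.above (next-least (suc (enum k)))

  enum-strictMono : ∀ {j k} → j < k → enum j < enum k
  enum-strictMono {j} {suc k} (s≤s j≤k) with m≤n⇒m<n∨m≡n j≤k
  ... | inj₁ j<k  = <-trans (enum-strictMono j<k) (enum-step k)
  ... | inj₂ refl = enum-step j

  enum-injective : ∀ {j k} → enum j ≡ enum k → j ≡ k
  enum-injective {j} {k} eq with <-cmp j k
  ... | tri< j<k _ _ = ⊥-elim (<⇒≱ (enum-strictMono j<k) (≤-reflexive (sym eq)))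
  ... | tri≈ _ j≡k _ = j≡k
  ... | tri> _ _ k<j = ⊥-elim (<⇒≱ (enum-strictMono k<j) (≤-reflexive eq))

  ≤-enum : ∀ k → k ≤ enum k
  ≤-enum zero    = z≤n
  ≤-enum (suc k) = ≤-trans (s≤s (≤-enum k)) (enum-step k)

  enum-reaches : ∀ {n} → U n → ∀ k → (∃ λ j → enum j ≡ n) ⊎ enum k < n
  enum-reaches {n} un zero with <-cmp (enum 0) n
  ... | tri< lt _ _ = inj₂ lt
  ... | tri≈ _ eq _ = inj₁ (0 , eq)
  ... | tri> _ _ gt = ⊥-elim (LeastFrom.least (next-least 0) z≤n gt un)
  enum-reaches {n} un (suc k) with enum-reaches un k
  ... | inj₁ found = inj₁ found
  ... | inj₂ lt with <-cmp (enum (suc k)) n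
  ...   | tri< lt′ _ _ = inj₂ lt′
  ...   | tri≈ _ eq _  = inj₁ (suc k , eq)
  ...   | tri> _ _ gt  = ⊥-elim (LeastFrom.least (next-least (suc (enum k))) lt gt un)

  enum-surjective : ∀ {n} → U n → ∃ λ k → enum k ≡ n
  enum-surjective {n} un with enum-reaches un n
  ... | inj₁ found = found
  ... | inj₂ lt    = ⊥-elim (<⇒≱ lt (≤-enum n))

module Transposition {S : Set} (_≟_ : DecidableEquality S) where

  swap : S → S → S → S
  swap a b x with x ≟ a
  ... | yes _ = b
  ... | no  _ with x ≟ b
  ...   | yes _ = a
  ...   | no  _ = x

  swap-left : ∀ a b → swap a b a ≡ b
  swap-left a b with a ≟ a
  ... | yes _ = refl
  ... | no a≢a = ⊥-elim (a≢a refl)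

  swap-right : ∀ a b → swap a b b ≡ a
  swap-right a b with b ≟ a
  ... | yes refl = refl
  ... | no _ with b ≟ b
  ...   | yes _ = refl
  ...   | no b≢b = ⊥-elim (b≢b refl)

  swap-other : ∀ {a b x} → x ≢ a → x ≢ b → swap a b x ≡ x
  swap-other {a} {b} {x} x≢a x≢b with x ≟ a
  ... | yes x≡a = ⊥-elim (x≢a x≡a)
  ... | no _ with x ≟ b
  ...   | yes x≡b = ⊥-elim (x≢b x≡b)
  ...   | no _ = refl

  swap-involutive : ∀ a b x → swap a b (swap a b x) ≡ x
  swap-involutive a b x with x ≟ a
  ... | yes refl = swap-right x b
  ... | no x≢a with x ≟ b
  ...   | yes refl = swap-left a x
  ...   | no x≢b = swap-other x≢a x≢b

  transposition : S → S → S ↔ S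
  transposition a b = mk↔ₛ′ (swap a b) (swap a b) (swap-involutive a b) (swap-involutive a b)

  PartialInjection : List (S × S) → Set
  PartialInjection L = ∀ {a b a′ b′} → (a , b) ∈ L → (a′ , b′) ∈ L →
                       (a ≡ a′ → b ≡ b′) × (b ≡ b′ → a ≡ a′)

  extension : List (S × S) → S ↔ S
  extension []            = ↔-refl
  extension ((a , b) ∷ L) = ↔-trans (extension L) (transposition (Inverse.to (extension L) a) b)

  extension-extends : ∀ L → PartialInjection L → ∀ {a b} → (a , b) ∈ L → Inverse.to (extension L) a ≡ b
  extension-extends ((a₀ , b₀) ∷ L) inj (here refl) = swap-left _ b₀
  extension-extends ((a₀ , b₀) ∷ L) inj {a} {b} (there ab∈L)
    with ih ← extension-extends L (λ p q → inj (there p) (there q)) ab∈L | b ≟ b₀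
  ... | yes refl = trans (cong₂ (λ c x → swap c b x) same ih) (swap-left b b)
    where
    same : Inverse.to (extension L) a₀ ≡ b
    same = trans (cong (Inverse.to (extension L)) (sym (proj₂ (inj (there ab∈L) (here refl)) refl))) ih
  ... | no b≢b₀ = trans (cong (swap (Inverse.to (extension L) a₀) b₀) ih) (swap-other b≢c b≢b₀)
    where
    b≢c : b ≢ Inverse.to (extension L) a₀
    b≢c b≡c = b≢b₀ (proj₁ (inj (there ab∈L) (here refl))
                      (Injection.injective (↔⇒↣ (extension L)) (trans ih b≡c)))

module _ {TP : TreePlan} where

  Iso-sym : {M N : Structure TP} → Iso M N → Iso N M
  Iso-sym {M} {N} I = record
    { bij       = ↔-sym (Iso.bij I)
    ; pres-ε    = trans (cong g (sym (Iso.pres-ε I))) (gf _)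
    ; pres-⊓    = λ x y →
        trans (cong g (trans (cong₂ N._⊓_ (sym (fg x)) (sym (fg y))) (sym (Iso.pres-⊓ I (g x) (g y))))) (gf _)
    ; pres-pred = λ x → trans (cong g (trans (cong N.pred (sym (fg x))) (sym (Iso.pres-pred I (g x))))) (gf _)
    ; pres-≤    = λ x y → mk⇔
        (λ x≤y → Equivalence.from (Iso.pres-≤ I (g x) (g y)) (subst₂ N._≤_ (sym (fg x)) (sym (fg y)) x≤y))
        (λ gx≤gy → subst₂ N._≤_ (fg x) (fg y) (Equivalence.to (Iso.pres-≤ I (g x) (g y)) gx≤gy))
    ; pres-P    = λ k x → mk⇔ (λ Px → Equivalence.from (Iso.pres-P I k (g x)) (subst (N.P k) (sym (fg x)) Px))
                               (λ Pgx → subst (N.P k) (fg x) (Equivalence.to (Iso.pres-P I k (g x)) Pgx))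
    }
    where
    module N = Structure N
    g = Inverse.from (Iso.bij I)
    fg = Inverse.strictlyInverseˡ (Iso.bij I)
    gf = Inverse.strictlyInverseʳ (Iso.bij I)

  Iso-trans : {M N K : Structure TP} → Iso M N → Iso N K → Iso M K
  Iso-trans I J = record
    { bij       = ↔-trans (Iso.bij I) (Iso.bij J)
    ; pres-ε    = trans (cong (Iso.f J) (Iso.pres-ε I)) (Iso.pres-ε J)
    ; pres-⊓    = λ x y → trans (cong (Iso.f J) (Iso.pres-⊓ I x y)) (Iso.pres-⊓ J _ _)
    ; pres-pred = λ x → trans (cong (Iso.f J) (Iso.pres-pred I x)) (Iso.pres-pred J _)
    ; pres-≤    = λ x y → ⇔-trans (Iso.pres-≤ I x y) (Iso.pres-≤ J _ _)
    ; pres-P    = λ k x → ⇔-trans (Iso.pres-P I k x) (Iso.pres-P J k _)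
    }

module Sequences (TP : TreePlan) (S : Set) (_≟S_ : DecidableEquality S) where
  open TreePlan TP
  open GammaS TP S _≟S_
  open DecMembership _≟ₗ_ using (_∈?_)

  Admissible : List ℕ → ℕ × Maybe S → Set
  Admissible σ (i , t) = (σ ∷ʳ i) ∈ Γ × Match (lab (σ ∷ʳ i)) t

  dropLast-∷ʳ : ∀ xs a → dropLast (xs ∷ʳ a) ≡ xs
  dropLast-∷ʳ []           a = refl
  dropLast-∷ʳ (x ∷ [])     a = refl
  dropLast-∷ʳ (x ∷ y ∷ xs) a = cong (x ∷_) (dropLast-∷ʳ (y ∷ xs) a)

  π-∷ʳ : ∀ xs a → π (xs ∷ʳ a) ≡ π xs ∷ʳ proj₁ a
  π-∷ʳ xs a = map-++ proj₁ xs (a ∷ [])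

  ∷ʳ-shape : ∀ ys {σ i} → π ys ≡ σ ∷ʳ i → ∃ λ ws → ∃ λ t → ys ≡ ws ∷ʳ (i , t) × π ws ≡ σ
  ∷ʳ-shape ys {σ} π≡ with reverseView ys
  ... | []                 = ⊥-elim (∷ʳ≢[] σ (sym π≡))
  ... | ws ∶ _ ∶ʳ (j , t)
    with πws≡ , refl ← ∷ʳ-injective (π ws) σ (trans (sym (π-∷ʳ ws (j , t))) π≡) = ws , t , refl , πws≡

  π-dropLast : ∀ xs {σ i} → π xs ≡ σ ∷ʳ i → π (dropLast xs) ≡ σ
  π-dropLast xs π≡ with ws , t , refl , πws≡ ← ∷ʳ-shape xs π≡ = trans (cong π (dropLast-∷ʳ ws _)) πws≡

  π≡[]⇒≡[] : ∀ {xs} → π xs ≡ [] → xs ≡ []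
  π≡[]⇒≡[] {[]} _ = refl

  Valid-∷ʳ⁻ : ∀ pre xs a → Valid pre (xs ∷ʳ a) → Valid pre xs × Admissible (pre ++ π xs) a
  Valid-∷ʳ⁻ pre [] (i , t) (p , m , _) =
    tt , subst (λ σ → Admissible σ (i , t)) (sym (++-identityʳ pre)) (T-does⇒ ((pre ∷ʳ i) ∈? Γ) p , m)
  Valid-∷ʳ⁻ pre ((j , _) ∷ xs) a (p , m , v) with Valid-∷ʳ⁻ (pre ∷ʳ j) xs a v
  ... | v′ , adm = (p , m , v′) , subst (λ σ → Admissible σ a) (∷ʳ-++ pre j (π xs)) adm

  Valid-∷ʳ⁺ : ∀ pre xs a → Valid pre xs → Admissible (pre ++ π xs) a → Valid pre (xs ∷ʳ a)
  Valid-∷ʳ⁺ pre [] (i , t) _ adm with subst (λ σ → Admissible σ (i , t)) (++-identityʳ pre) adm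
  ... | σi∈Γ , m = ⇒T-does ((pre ∷ʳ i) ∈? Γ) σi∈Γ , m , tt
  Valid-∷ʳ⁺ pre ((j , _) ∷ xs) a (p , m , v) adm =
    p , m , Valid-∷ʳ⁺ (pre ∷ʳ j) xs a v (subst (λ σ → Admissible σ a) (sym (∷ʳ-++ pre j (π xs))) adm)

  Match-irrelevant : ∀ l t (p q : Match l t) → p ≡ q
  Match-irrelevant one nothing  _ _ = refl
  Match-irrelevant inf (just _) _ _ = refl

  Match-one : ∀ {l t} → l ≡ one → Match l t → t ≡ nothing
  Match-one {one} {nothing} _ _ = refl

  Match-inf : ∀ {l t} → l ≡ inf → Match l t → ∃ λ s → t ≡ just s
  Match-inf {inf} {just s} _ _ = s , refl

  Match-cases : ∀ {l t} → Match l t → (l ≡ one × t ≡ nothing) ⊎ (l ≡ inf × ∃ λ s → t ≡ just s)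
  Match-cases {one} {nothing} _ = inj₁ (refl , refl)
  Match-cases {inf} {just s}  _ = inj₂ (refl , s , refl)

  Match-map : ∀ {l t} (f : S → S) → Match l t → Match l (Maybe.map f t)
  Match-map {one} {nothing} f _ = tt
  Match-map {inf} {just _}  f _ = tt

  Valid-irrelevant : ∀ pre xs (p q : Valid pre xs) → p ≡ q
  Valid-irrelevant pre []             _           _              = refl
  Valid-irrelevant pre ((i , t) ∷ xs) (p , m , v) (p′ , m′ , v′) =
    cong₂ _,_ (T-irrelevant p p′) (cong₂ _,_ (Match-irrelevant _ t m m′) (Valid-irrelevant _ xs v v′))

  Elem-≡ : {x y : Elem} → proj₁ x ≡ proj₁ y → x ≡ y
  Elem-≡ {xs , v} {.xs , w} refl = cong (xs ,_) (Valid-irrelevant [] xs v w)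

  one-labelled-siblings : ∀ {xs ys} → Valid [] xs → Valid [] ys → π xs ≡ π ys → lab (π xs) ≡ one →
                          dropLast xs ≡ dropLast ys → xs ≡ ys
  one-labelled-siblings {xs} {ys} = go (reverseView xs) (reverseView ys)
    where
    go : ∀ {xs ys} → Reverse xs → Reverse ys → Valid [] xs → Valid [] ys → π xs ≡ π ys → lab (π xs) ≡ one →
         dropLast xs ≡ dropLast ys → xs ≡ ys
    go []            _  _ _ π≡ _ _ = sym (π≡[]⇒≡[] (sym π≡))
    go (xs ∶ _ ∶ʳ a) [] _ _ π≡ _ _ = ⊥-elim (∷ʳ≢[] (π xs) (trans (sym (π-∷ʳ xs a)) π≡))
    go (xs ∶ _ ∶ʳ (i , t)) (ys ∶ _ ∶ʳ (j , u)) vx vy π≡ lab≡ dropLast≡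
      with refl ← trans (sym (dropLast-∷ʳ xs (i , t))) (trans dropLast≡ (dropLast-∷ʳ ys (j , u)))
      with _ , refl ← ∷ʳ-injective (π xs) (π xs) (trans (sym (π-∷ʳ xs (i , t))) (trans π≡ (π-∷ʳ xs (j , u))))
      = cong (λ t → xs ∷ʳ (i , t)) (trans (Match-one lab-one (proj₂ (proj₂ (Valid-∷ʳ⁻ [] xs (i , t) vx))))
                                         (sym (Match-one lab-one (proj₂ (proj₂ (Valid-∷ʳ⁻ [] xs (i , u) vy))))))
      where
      lab-one : lab (π xs ∷ʳ i) ≡ one
      lab-one = trans (cong lab (sym (π-∷ʳ xs (i , t)))) lab≡

  Valid⇒∈Γ : ∀ pre xs → pre ∈ Γ → Valid pre xs → (pre ++ π xs) ∈ Γ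
  Valid⇒∈Γ pre []             pre∈Γ _           = subst (_∈ Γ) (sym (++-identityʳ pre)) pre∈Γ
  Valid⇒∈Γ pre ((i , _) ∷ xs) _     (p , _ , v) =
    subst (_∈ Γ) (∷ʳ-++ pre i (π xs)) (Valid⇒∈Γ (pre ∷ʳ i) xs (T-does⇒ ((pre ∷ʳ i) ∈? Γ) p) v)

  π∈Γ : (x : Elem) → π (proj₁ x) ∈ Γ
  π∈Γ (xs , v) = Valid⇒∈Γ [] xs Γ-root v

  depth : ℕ
  depth = max 0 (map length Γ)

  depth-bound : (x : Elem) → length (proj₁ x) ≤ depth
  depth-bound x = subst (_≤ depth) (length-map proj₁ (proj₁ x))
                        (All.lookup (xs≤max 0 (map length Γ)) (∈-map⁺ length (π∈Γ x)))

  ≼-refl : ∀ xs → xs ≼ xs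
  ≼-refl xs = [] , ++-identityʳ xs

  ≼-trans : ∀ {xs ys zs} → xs ≼ ys → ys ≼ zs → xs ≼ zs
  ≼-trans {xs} (as , refl) (bs , refl) = as ++ bs , sym (++-assoc xs as bs)

  ≼-antisym : ∀ {xs ys} → xs ≼ ys → ys ≼ xs → xs ≡ ys
  ≼-antisym {xs} (as , refl) (bs , eq)
    with refl ← ++-conicalˡ as bs (++-identityʳ-unique xs (trans (sym eq) (++-assoc xs as bs))) =
    sym (++-identityʳ xs)

  []≼ : ∀ xs → [] ≼ xs
  []≼ xs = xs , refl

  ≼[]⇒≡[] : ∀ {xs} → xs ≼ [] → xs ≡ []
  ≼[]⇒≡[] {xs} (zs , eq) = ++-conicalˡ xs zs eq

  dropLast-≼ : ∀ xs → dropLast xs ≼ xs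
  dropLast-≼ []           = [] , refl
  dropLast-≼ (x ∷ [])     = x ∷ [] , refl
  dropLast-≼ (x ∷ y ∷ xs) with dropLast-≼ (y ∷ xs)
  ... | zs , eq = zs , cong (x ∷_) eq

  iterate-dropLast-≼ : ∀ xs d → iterate dropLast xs d ≼ xs
  iterate-dropLast-≼ xs zero    = ≼-refl xs
  iterate-dropLast-≼ xs (suc d) = ≼-trans (iterate-dropLast-≼ (dropLast xs) d) (dropLast-≼ xs)

  iterate-dropLast-++ : ∀ xs zs → iterate dropLast (xs ++ zs) (length zs) ≡ xs
  iterate-dropLast-++ xs zs = go zs (reverseView zs)
    where
    go : ∀ zs → Reverse zs → iterate dropLast (xs ++ zs) (length zs) ≡ xs
    go .[]        []            = ++-identityʳ xs
    go .(zs ∷ʳ z) (zs ∶ r ∶ʳ z)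
      rewrite length-++ zs {z ∷ []} | +-comm (length zs) 1 | sym (++-assoc xs zs (z ∷ [])) | dropLast-∷ʳ (xs ++ zs) z
      = go zs r

  ≼⇒iterate-dropLast : ∀ {xs ys} → xs ≼ ys → ∃ λ d → d ≤ length ys × xs ≡ iterate dropLast ys d
  ≼⇒iterate-dropLast {xs} (zs , refl) =
    length zs , ≤-trans (m≤n+m (length zs) (length xs)) (≤-reflexive (sym (length-++ xs))) ,
    sym (iterate-dropLast-++ xs zs)

  proj₁-iterate-pred : ∀ x d → proj₁ (iterate (Structure.pred structure) x d) ≡ iterate dropLast (proj₁ x) d
  proj₁-iterate-pred = iterate-commute proj₁ (λ _ → refl)

  lcp-≼ˡ : ∀ xs ys → lcp xs ys ≼ xs
  lcp-≼ˡ []       ys       = []≼ []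
  lcp-≼ˡ (x ∷ xs) []       = []≼ _
  lcp-≼ˡ (a ∷ xs) (b ∷ ys) with a ≟e b
  ... | yes _ = let zs , eq = lcp-≼ˡ xs ys in zs , cong (a ∷_) eq
  ... | no  _ = []≼ _

  lcp-≼ʳ : ∀ xs ys → lcp xs ys ≼ ys
  lcp-≼ʳ []       ys       = []≼ ys
  lcp-≼ʳ (x ∷ xs) []       = []≼ _
  lcp-≼ʳ (a ∷ xs) (b ∷ ys) with a ≟e b
  ... | yes refl = let zs , eq = lcp-≼ʳ xs ys in zs , cong (a ∷_) eq
  ... | no  _    = []≼ _

  lcp-greatest : ∀ {zs xs ys} → zs ≼ xs → zs ≼ ys → zs ≼ lcp xs ys
  lcp-greatest {[]}     _          _          = []≼ _
  lcp-greatest {c ∷ zs} (as , refl) (bs , refl) with c ≟e c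
  ... | yes _ = let ws , eq = lcp-greatest {zs} (as , refl) (bs , refl) in ws , cong (c ∷_) eq
  ... | no c≢c = ⊥-elim (c≢c refl)

module Formulas (TP : TreePlan) where

  ⊤′ : ∀ {n} → Formula TP n
  ⊤′ = ⊥' ⇒' ⊥'

  -- restricts an instance of an axiom scheme over positions of Γ to those satisfying a metalevel condition
  when : ∀ {A : Set} {n} → Dec A → Formula TP n → Formula TP n
  when (yes _) φ = φ
  when (no  _) φ = ⊤′

  ⋀ : ∀ {m n} → (Fin m → Formula TP n) → Formula TP n
  ⋀ {zero}  φ = ⊤′
  ⋀ {suc m} φ = φ zero ∧' ⋀ (φ ∘ suc)

  ⋁ : ∀ {m n} → (Fin m → Formula TP n) → Formula TP n
  ⋁ {zero}  φ = ⊥'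
  ⋁ {suc m} φ = φ zero ∨' ⋁ (φ ∘ suc)

  _⇔'_ : ∀ {n} → Formula TP n → Formula TP n → Formula TP n
  φ ⇔' ψ = (φ ⇒' ψ) ∧' (ψ ⇒' φ)

  ⋁≤ : ∀ {n} → ℕ → (ℕ → Formula TP n) → Formula TP n
  ⋁≤ b φ = ⋁ (λ (d : Fin (suc b)) → φ (toℕ d))

  ∀ⁿ : ∀ m {n} → Formula TP (m + n) → Formula TP n
  ∀ⁿ zero    φ = φ
  ∀ⁿ (suc m) φ = ∀ⁿ m (∀' φ)

  pred^ : ∀ {n} → ℕ → Term TP n → Term TP n
  pred^ zero    t = t
  pred^ (suc d) t = pred^ d (pred' t)

  module Semantics (M : Structure TP) where
    open Structure M using (Carrier; pred)

    -- v zero becomes the innermost (most recently bound) variable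
    _++ᵉ_ : ∀ {m n} → (Fin m → Carrier) → (Fin n → Carrier) → Fin (m + n) → Carrier
    _++ᵉ_ {zero}  v ρ = ρ
    _++ᵉ_ {suc m} v ρ = extend M (v zero) ((v ∘ suc) ++ᵉ ρ)

    ++ᵉ-↑ʳ : ∀ {m n} (v : Fin m → Carrier) (ρ : Fin n → Carrier) i → (v ++ᵉ ρ) (m ↑ʳ i) ≡ ρ i
    ++ᵉ-↑ʳ {zero}  v ρ i = refl
    ++ᵉ-↑ʳ {suc m} v ρ i = ++ᵉ-↑ʳ (v ∘ suc) ρ i

    ++ᵉ-↑ˡ : ∀ {m n} (v : Fin m → Carrier) (ρ : Fin n → Carrier) j → (v ++ᵉ ρ) (j ↑ˡ n) ≡ v j
    ++ᵉ-↑ˡ v ρ zero    = refl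
    ++ᵉ-↑ˡ v ρ (suc j) = ++ᵉ-↑ˡ (v ∘ suc) ρ j

    ∀ⁿ-elim : ∀ m {n} {ρ : Fin n → Carrier} φ → Sat M ρ (∀ⁿ m φ) → ∀ v → Sat M (v ++ᵉ ρ) φ
    ∀ⁿ-elim zero    φ s v = s
    ∀ⁿ-elim (suc m) φ s v = ∀ⁿ-elim m (∀' φ) s (v ∘ suc) (v zero)

    ∀ⁿ-intro : ∀ m {n} {ρ : Fin n → Carrier} φ → (∀ v → Sat M (v ++ᵉ ρ) φ) → Sat M ρ (∀ⁿ m φ)
    ∀ⁿ-intro zero    φ s = s (λ ())
    ∀ⁿ-intro (suc m) φ s = ∀ⁿ-intro m (∀' φ) (λ v x → s (λ { zero → x ; (suc j) → v j }))

    when-elim : ∀ {A : Set} {n} {ρ : Fin n → Carrier} (A? : Dec A) φ → Sat M ρ (when A? φ) → A → Sat M ρ φ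
    when-elim (yes _) φ s _ = s
    when-elim (no ¬a) φ _ a = ⊥-elim (¬a a)

    when-intro : ∀ {A : Set} {n} {ρ : Fin n → Carrier} (A? : Dec A) φ → (A → Sat M ρ φ) → Sat M ρ (when A? φ)
    when-intro (yes a) φ s = s a
    when-intro (no  _) φ _ = id

    ⋀-elim : ∀ {m n} {ρ : Fin n → Carrier} (φ : Fin m → Formula TP n) → Sat M ρ (⋀ φ) → ∀ j → Sat M ρ (φ j)
    ⋀-elim φ (s , _) zero    = s
    ⋀-elim φ (_ , s) (suc j) = ⋀-elim (φ ∘ suc) s j

    ⋀-intro : ∀ {m n} {ρ : Fin n → Carrier} (φ : Fin m → Formula TP n) → (∀ j → Sat M ρ (φ j)) → Sat M ρ (⋀ φ)
    ⋀-intro {zero}  φ s = id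
    ⋀-intro {suc m} φ s = s zero , ⋀-intro (φ ∘ suc) (s ∘ suc)

    ⋁-elim : ∀ {m n} {ρ : Fin n → Carrier} (φ : Fin m → Formula TP n) → Sat M ρ (⋁ φ) → ∃ λ j → Sat M ρ (φ j)
    ⋁-elim {suc m} φ (inj₁ s) = zero , s
    ⋁-elim {suc m} φ (inj₂ s) = let j , s′ = ⋁-elim (φ ∘ suc) s in suc j , s′

    ⋁-intro : ∀ {m n} {ρ : Fin n → Carrier} (φ : Fin m → Formula TP n) j → Sat M ρ (φ j) → Sat M ρ (⋁ φ)
    ⋁-intro φ zero    s = inj₁ s
    ⋁-intro φ (suc j) s = inj₂ (⋁-intro (φ ∘ suc) j s)

    ⋁≤-elim : ∀ {n b} {ρ : Fin n → Carrier} (φ : ℕ → Formula TP n) → Sat M ρ (⋁≤ b φ) →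
              ∃ λ d → d ≤ b × Sat M ρ (φ d)
    ⋁≤-elim {b = b} φ s =
      let d , s′ = ⋁-elim (λ (d : Fin (suc b)) → φ (toℕ d)) s in toℕ d , toℕ≤pred[n] d , s′

    ⋁≤-intro : ∀ {n b d} {ρ : Fin n → Carrier} (φ : ℕ → Formula TP n) → d ≤ b → Sat M ρ (φ d) →
               Sat M ρ (⋁≤ b φ)
    ⋁≤-intro {b = b} {ρ = ρ} φ d≤b s =
      ⋁-intro (λ (d : Fin (suc b)) → φ (toℕ d)) (fromℕ< (s≤s d≤b))
              (subst (Sat M ρ ∘ φ) (sym (toℕ-fromℕ< (s≤s d≤b))) s)

    eval-pred^ : ∀ {n} (ρ : Fin n → Carrier) d t → eval M ρ (pred^ d t) ≡ iterate pred (eval M ρ t) d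
    eval-pred^ ρ zero    t = refl
    eval-pred^ ρ (suc d) t = eval-pred^ ρ d (pred' t)

module Reconstruction (TP : TreePlan) (S : Set) (_≟S_ : DecidableEquality S) where
  open TreePlan TP
  open GammaS TP S _≟S_
  open Sequences TP S _≟S_

  position : ∀ {σ} → σ ∈ Γ → Fin (length Γ)
  position = index

  lookup-position : ∀ {σ} (σ∈Γ : σ ∈ Γ) → lookup Γ (position σ∈Γ) ≡ σ
  lookup-position σ∈Γ = sym (lookup-index σ∈Γ)

  Over : (M : Structure TP) → List ℕ → Structure.Carrier M → Set
  Over M σ x = ∃ λ k → lookup Γ k ≡ σ × Structure.P M k x

  -- ≤ is first-order expressible through pred because Γ has bounded depth
  record TreeAxioms (M : Structure TP) : Set where
    open Structure M renaming (_≤_ to _⊑_)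
    field
      sort-exists     : ∀ x → ∃ λ k → P k x
      sort-unique     : ∀ x {k l} → P k x → P l x → k ≡ l
      root-sort       : ∀ k → lookup Γ k ≡ [] → P k ε
      root-unique     : ∀ k x → lookup Γ k ≡ [] → P k x → x ≡ ε
      pred-sort       : ∀ k l i x → lookup Γ k ≡ lookup Γ l ∷ʳ i → P k x → P l (pred x)
      pred-ε          : pred ε ≡ ε
      ≤⇔iterate-pred  : ∀ x y → (x ⊑ y) ⇔ (∃ λ d → d ≤ depth × x ≡ iterate pred y d)
      ⊓-glb           : ∀ x y → (x ⊓ y) ⊑ x × (x ⊓ y) ⊑ y × (∀ z → z ⊑ x → z ⊑ y → z ⊑ (x ⊓ y))

    Over-unique : ∀ {σ τ x} → Over M σ x → Over M τ x → σ ≡ τ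
    Over-unique {x = x} (k , refl , Pkx) (l , refl , Plx) = cong (lookup Γ) (sort-unique x Pkx Plx)

    Over-root : Over M [] ε
    Over-root = position Γ-root , lookup-position Γ-root , root-sort _ (lookup-position Γ-root)

  -- child xs m i t is to be the image of xs ∷ʳ (i , t) when m is the image of xs
  record ChildChoice (M : Structure TP) : Set where
    open Structure M hiding (_≤_)
    field
      child            : Seq → Carrier → ℕ → Maybe S → Carrier
      child-over       : ∀ {xs m i t} → Over M (π xs) m → Admissible (π xs) (i , t) →
                         Over M (π xs ∷ʳ i) (child xs m i t) × pred (child xs m i t) ≡ m
      child-injective  : ∀ {xs m i t t′} → Over M (π xs) m →
                         Admissible (π xs) (i , t) → Admissible (π xs) (i , t′) →
                         child xs m i t ≡ child xs m i t′ → t ≡ t′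
      child-surjective : ∀ {xs m i y} → Over M (π xs) m → (π xs ∷ʳ i) ∈ Γ →
                         Over M (π xs ∷ʳ i) y → pred y ≡ m →
                         ∃ λ t → Admissible (π xs) (i , t) × child xs m i t ≡ y

  module Reconstruct {M : Structure TP} (ax : TreeAxioms M) (cc : ChildChoice M) where
    open Structure M renaming (_≤_ to _⊑_)
    open TreeAxioms ax
    open ChildChoice cc

    image-from : Seq → Carrier → Seq → Carrier
    image-from p m []            = m
    image-from p m ((i , t) ∷ r) = image-from (p ∷ʳ (i , t)) (child p m i t) r

    image : Seq → Carrier
    image = image-from [] ε

    image-from-∷ʳ : ∀ p m r i t → image-from p m (r ∷ʳ (i , t)) ≡ child (p ++ r) (image-from p m r) i t
    image-from-∷ʳ p m []            i t = cong (λ q → child q m i t) (sym (++-identityʳ p))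
    image-from-∷ʳ p m ((j , u) ∷ r) i t =
      trans (image-from-∷ʳ (p ∷ʳ (j , u)) (child p m j u) r i t)
            (cong (λ q → child q (image-from (p ∷ʳ (j , u)) (child p m j u) r) i t) (∷ʳ-++ p (j , u) r))

    image-∷ʳ : ∀ xs i t → image (xs ∷ʳ (i , t)) ≡ child xs (image xs) i t
    image-∷ʳ = image-from-∷ʳ [] ε

    image-over : ∀ xs → Valid [] xs → Over M (π xs) (image xs)
    image-over xs = go (reverseView xs)
      where
      go : ∀ {xs} → Reverse xs → Valid [] xs → Over M (π xs) (image xs)
      go []                   _ = Over-root
      go (xs ∶ r ∶ʳ (i , t)) v with v′ , adm ← Valid-∷ʳ⁻ [] xs (i , t) v
        rewrite π-∷ʳ xs (i , t) | image-∷ʳ xs i t = proj₁ (child-over (go r v′) adm)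

    image-parent : ∀ xs i t → Valid [] (xs ∷ʳ (i , t)) → image xs ≡ pred (image (xs ∷ʳ (i , t)))
    image-parent xs i t v = let v′ , adm = Valid-∷ʳ⁻ [] xs (i , t) v in begin
      image xs                          ≡⟨ proj₂ (child-over (image-over xs v′) adm) ⟨
      pred (child xs (image xs) i t)    ≡⟨ cong pred (image-∷ʳ xs i t) ⟨
      pred (image (xs ∷ʳ (i , t)))      ∎
      where open ≡-Reasoning

    image-dropLast : ∀ xs → Valid [] xs → image (dropLast xs) ≡ pred (image xs)
    image-dropLast xs v with reverseView xs
    ... | []                 = sym pred-ε
    ... | ys ∶ _ ∶ʳ (i , t)  = trans (cong image (dropLast-∷ʳ ys (i , t))) (image-parent ys i t v)

    image-injective : ∀ {xs ys} → Valid [] xs → Valid [] ys → image xs ≡ image ys → xs ≡ ys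
    image-injective {xs} {ys} = go (reverseView xs) (reverseView ys)
      where
      same-π : ∀ {xs ys} → Valid [] xs → Valid [] ys → image xs ≡ image ys → π xs ≡ π ys
      same-π {xs} {ys} vx vy eq = Over-unique (image-over xs vx) (subst (Over M (π ys)) (sym eq) (image-over ys vy))

      go : ∀ {xs ys} → Reverse xs → Reverse ys → Valid [] xs → Valid [] ys → image xs ≡ image ys → xs ≡ ys
      go [] [] _ _ _ = refl
      go [] (ys ∶ _ ∶ʳ a) vx vy eq = ⊥-elim (∷ʳ≢[] (π ys) (sym (trans (same-π vx vy eq) (π-∷ʳ ys a))))
      go (xs ∶ _ ∶ʳ a) [] vx vy eq = ⊥-elim (∷ʳ≢[] (π xs) (trans (sym (π-∷ʳ xs a)) (same-π vx vy eq)))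
      go (xs ∶ rx ∶ʳ (i , t)) (ys ∶ ry ∶ʳ (j , u)) vx vy eq
        with vx′ , admt ← Valid-∷ʳ⁻ [] xs (i , t) vx
           | vy′ , admu ← Valid-∷ʳ⁻ [] ys (j , u) vy
        with _ , refl ← ∷ʳ-injective (π xs) (π ys)
                          (trans (sym (π-∷ʳ xs _)) (trans (same-π vx vy eq) (π-∷ʳ ys _)))
        with refl ← go rx ry vx′ vy′
                      (trans (image-parent xs i t vx) (trans (cong pred eq) (sym (image-parent ys i u vy))))
        = cong (λ t → xs ∷ʳ (i , t))
            (child-injective (image-over xs vx′) admt admu (trans (sym (image-∷ʳ xs i t)) (trans eq (image-∷ʳ xs i u))))

    image-surjective : ∀ m → ∃ λ xs → Valid [] xs × image xs ≡ m
    image-surjective m = let k , Pkm = sort-exists m in go (reverseView (lookup Γ k)) (k , refl , Pkm)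
      where
      go : ∀ {σ} → Reverse σ → ∀ {m} → Over M σ m → ∃ λ xs → Valid [] xs × image xs ≡ m
      go [] {m} (k , σ≡[] , Pkm) = [] , tt , sym (root-unique k m σ≡[] Pkm)
      go (σ ∶ r ∶ʳ i) {m} (k , eq , Pkm)
        with σi∈Γ ← subst (_∈ Γ) eq (∈-lookup k)
        with σ∈Γ ← Γ-closed σ (i ∷ []) σi∈Γ
        with over-pred ← (position σ∈Γ , lookup-position σ∈Γ ,
                          pred-sort k _ i m (trans eq (cong (_∷ʳ i) (sym (lookup-position σ∈Γ)))) Pkm)
        with xs , v , img ← go r over-pred
        with refl ← Over-unique (image-over xs v) (subst (Over M σ) (sym img) over-pred)
        with t , adm , child≡m ← child-surjective (image-over xs v) σi∈Γ (k , eq , Pkm) (sym img)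
        = xs ∷ʳ (i , t) , Valid-∷ʳ⁺ [] xs (i , t) v adm , trans (image-∷ʳ xs i t) child≡m

    img : Elem → Carrier
    img x = image (proj₁ x)

    img-injective : ∀ {x y} → img x ≡ img y → x ≡ y
    img-injective {x} {y} eq = Elem-≡ (image-injective (proj₂ x) (proj₂ y) eq)

    img-iterate-pred : ∀ x d → img (iterate (Structure.pred structure) x d) ≡ iterate pred (img x) d
    img-iterate-pred = iterate-commute img (λ x → image-dropLast (proj₁ x) (proj₂ x))

    img-≼ : ∀ x y → proj₁ x ≼ proj₁ y → img x ⊑ img y
    img-≼ x y x≼y = let d , d≤ , x≡ = ≼⇒iterate-dropLast x≼y in
      Equivalence.from (≤⇔iterate-pred (img x) (img y))
        (d , ≤-trans d≤ (depth-bound y) ,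
         trans (cong image (trans x≡ (sym (proj₁-iterate-pred y d)))) (img-iterate-pred y d))

    img-⊑ : ∀ x y → img x ⊑ img y → proj₁ x ≼ proj₁ y
    img-⊑ x y x⊑y = let d , _ , x≡ = Equivalence.to (≤⇔iterate-pred (img x) (img y)) x⊑y in
      subst (_≼ proj₁ y)
        (trans (sym (proj₁-iterate-pred y d))
               (cong proj₁ (img-injective {iterate (Structure.pred structure) y d} {x}
                                          (sym (trans x≡ (sym (img-iterate-pred y d)))))))
        (iterate-dropLast-≼ (proj₁ y) d)

    img-⊓ : ∀ x y → img (Structure._⊓_ structure x y) ≡ img x ⊓ img y
    img-⊓ x y with image-surjective (img x ⊓ img y) | ⊓-glb (img x) (img y)
    ... | zs , v , img-z | z⊑x , z⊑y , greatest = trans (cong img (Elem-≡ {l} {z} (≼-antisym lcp≼z z≼lcp))) img-z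
      where
      l z : Elem
      l = Structure._⊓_ structure x y
      z = zs , v
      z≼lcp : zs ≼ proj₁ l
      z≼lcp = lcp-greatest (img-⊑ z x (subst (_⊑ img x) (sym img-z) z⊑x))
                           (img-⊑ z y (subst (_⊑ img y) (sym img-z) z⊑y))
      lcp≼z : proj₁ l ≼ zs
      lcp≼z = img-⊑ l z (subst (img l ⊑_) (sym img-z)
                (greatest (img l) (img-≼ l x (lcp-≼ˡ (proj₁ x) (proj₁ y)))
                                  (img-≼ l y (lcp-≼ʳ (proj₁ x) (proj₁ y)))))

    img-P : ∀ k x → (π (proj₁ x) ≡ lookup Γ k) ⇔ P k (img x)
    img-P k x = mk⇔
      (λ π≡ → let k′ , k′≡ , Pk′ = image-over (proj₁ x) (proj₂ x) in
              subst (λ k → P k (img x)) (lookup-injective Γ-unique (trans k′≡ π≡)) Pk′)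
      (λ Pk → Over-unique (image-over (proj₁ x) (proj₂ x)) (k , refl , Pk))

    ≅ : Iso structure M
    ≅ = record
      { bij       = mk↔ₛ′ img unimage (λ m → proj₂ (proj₂ (image-surjective m)))
                                      (λ x → img-injective (proj₂ (proj₂ (image-surjective (img x)))))
      ; pres-ε    = refl
      ; pres-⊓    = img-⊓
      ; pres-pred = λ x → image-dropLast (proj₁ x) (proj₂ x)
      ; pres-≤    = λ x y → mk⇔ (img-≼ x y) (img-⊑ x y)
      ; pres-P    = img-P
      }
      where
      unimage : Carrier → Elem
      unimage m = let xs , v , _ = image-surjective m in xs , v

module Theory (em : ExcludedMiddle 0ℓ) (TP : TreePlan) {S : Set} (e : S ↔ ℕ) where
  open TreePlan TP
  open GammaS TP S (decEq-from-↔ℕ e)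
  open Sequences TP S (decEq-from-↔ℕ e)
  open Reconstruction TP S (decEq-from-↔ℕ e)
  open Formulas TP
  module ΓS = Semantics structure

  v₀ : ∀ {n} → Term TP (suc n)
  v₀ = var zero
  v₁ : ∀ {n} → Term TP (suc (suc n))
  v₁ = var (suc zero)
  v₂ : ∀ {n} → Term TP (suc (suc (suc n)))
  v₂ = var (suc (suc zero))

  Over-π : ∀ σ x → Over structure σ x → π (proj₁ x) ≡ σ
  Over-π _ _ (_ , k≡ , Pk) = trans Pk k≡

  ChildSort : Fin (length Γ) → Fin (length Γ) → Lab → Set
  ChildSort k l λk = ∃ λ i → lookup Γ k ≡ lookup Γ l ∷ʳ i × lab (lookup Γ k) ≡ λk

  disjoint : Fin (length Γ) → Fin (length Γ) → Formula TP 1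
  disjoint k l = ¬' ((P' k v₀) ∧' (P' l v₀))

  root-of-sort : Fin (length Γ) → Sentence TP
  root-of-sort k = (P' k ε') ∧' (∀' ((P' k v₀) ⇒' (v₀ ≐ ε')))

  parent-of-sort : Fin (length Γ) → Fin (length Γ) → Formula TP 1
  parent-of-sort k l = (P' k v₀) ⇒' (P' l (pred' v₀))

  below : ℕ → Formula TP 2
  below d = v₁ ≐ pred^ d v₀

  has-child : Fin (length Γ) → Fin (length Γ) → Sentence TP
  has-child k l = ∀' ((P' l v₀) ⇒' (∃' ((P' k v₀) ∧' (pred' v₀ ≐ v₁))))

  siblings-equal : Fin (length Γ) → Sentence TP
  siblings-equal k = ∀' ∀' (((P' k v₁) ∧' ((P' k v₀) ∧' (pred' v₁ ≐ pred' v₀))) ⇒' (v₁ ≐ v₀))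

  -- v₀ is the new child, the outermost variable its parent, and the n variables in between are avoided
  has-fresh-child : ℕ → Fin (length Γ) → Fin (length Γ) → Sentence TP
  has-fresh-child n k l =
    ∀' ((P' l v₀) ⇒' ∀ⁿ n (∃' ((P' k v₀) ∧' ((pred' v₀ ≐ var (suc (n ↑ʳ zero))) ∧' avoids))))
    where
    avoids : Formula TP (suc (n + 1))
    avoids = ⋀ λ j → ¬' (v₀ ≐ var (suc (j ↑ˡ 1)))

  ax-sort : Sentence TP
  ax-sort = ∀' ⋁ λ k → P' k v₀

  ax-sort-unique : Sentence TP
  ax-sort-unique = ∀' ⋀ λ k → ⋀ λ l → when (em {k ≢ l}) (disjoint k l)

  ax-root : Sentence TP
  ax-root = ⋀ λ k → when (em {lookup Γ k ≡ []}) (root-of-sort k)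

  ax-pred-sort : Sentence TP
  ax-pred-sort = ∀' ⋀ λ k → ⋀ λ l →
    when (em {∃ λ i → lookup Γ k ≡ lookup Γ l ∷ʳ i}) (parent-of-sort k l)

  ax-pred-ε : Sentence TP
  ax-pred-ε = pred' ε' ≐ ε'

  ax-order : Sentence TP
  ax-order = ∀' ∀' ((v₁ ≤' v₀) ⇔' ⋁≤ depth below)

  ax-meet : Sentence TP
  ax-meet = ∀' ∀' ((meet v₁ v₀ ≤' v₁) ∧'
                   ((meet v₁ v₀ ≤' v₀) ∧' (∀' ((v₀ ≤' v₂) ⇒' ((v₀ ≤' v₁) ⇒' (v₀ ≤' meet v₂ v₁))))))

  ax-one-child : Sentence TP
  ax-one-child = ⋀ λ k → ⋀ λ l → when (em {ChildSort k l one}) (has-child k l)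

  ax-one-unique : Sentence TP
  ax-one-unique = ⋀ λ k → when (em {lab (lookup Γ k) ≡ one}) (siblings-equal k)

  ax-many-children : ℕ → Sentence TP
  ax-many-children n = ⋀ λ k → ⋀ λ l → when (em {ChildSort k l inf}) (has-fresh-child n k l)

  ΓS⊨ax-sort : structure ⊨ ax-sort
  ΓS⊨ax-sort x = ΓS.⋁-intro (λ k → P' k v₀) (position (π∈Γ x)) (sym (lookup-position (π∈Γ x)))

  ΓS⊨ax-sort-unique : structure ⊨ ax-sort-unique
  ΓS⊨ax-sort-unique x = ΓS.⋀-intro _ λ k → ΓS.⋀-intro _ λ l → ΓS.when-intro em (disjoint k l)
    λ k≢l (Pk , Pl) → k≢l (lookup-injective Γ-unique (trans (sym Pk) Pl))

  ΓS⊨ax-root : structure ⊨ ax-root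
  ΓS⊨ax-root = ΓS.⋀-intro (λ k → when em (root-of-sort k)) λ k → ΓS.when-intro em (root-of-sort k)
    λ σ≡[] → sym σ≡[] , λ x Pk → Elem-≡ (π≡[]⇒≡[] (trans Pk σ≡[]))

  ΓS⊨ax-pred-sort : structure ⊨ ax-pred-sort
  ΓS⊨ax-pred-sort x = ΓS.⋀-intro _ λ k → ΓS.⋀-intro _ λ l → ΓS.when-intro em (parent-of-sort k l)
    λ (i , σk≡) Pk → π-dropLast (proj₁ x) (trans Pk σk≡)

  ΓS⊨ax-pred-ε : structure ⊨ ax-pred-ε
  ΓS⊨ax-pred-ε = refl

  ΓS⊨ax-order : structure ⊨ ax-order
  ΓS⊨ax-order x y = ≼⇒⋁ , ⋁⇒≼
    where
    ρ = extend structure y (extend structure x (λ ()))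
    ≼⇒⋁ : proj₁ x ≼ proj₁ y → Sat structure ρ (⋁≤ depth below)
    ≼⇒⋁ x≼y = let d , d≤ , x≡ = ≼⇒iterate-dropLast x≼y in
      ΓS.⋁≤-intro below (≤-trans d≤ (depth-bound y))
        (trans (Elem-≡ (trans x≡ (sym (proj₁-iterate-pred y d)))) (sym (ΓS.eval-pred^ ρ d v₀)))
    ⋁⇒≼ : Sat structure ρ (⋁≤ depth below) → proj₁ x ≼ proj₁ y
    ⋁⇒≼ s = let d , _ , x≡ = ΓS.⋁≤-elim {b = depth} {ρ = ρ} below s in
      subst (_≼ proj₁ y) (sym (trans (cong proj₁ (trans x≡ (ΓS.eval-pred^ ρ d v₀))) (proj₁-iterate-pred y d)))
        (iterate-dropLast-≼ (proj₁ y) d)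
  ΓS⊨ax-meet : structure ⊨ ax-meet
  ΓS⊨ax-meet x y = lcp-≼ˡ (proj₁ x) (proj₁ y) , lcp-≼ʳ (proj₁ x) (proj₁ y) , λ _ → lcp-greatest

  child-of-sort : ∀ {k l λk} (c : ChildSort k l λk) (x : Elem) → π (proj₁ x) ≡ lookup Γ l → ∀ {t} → Match λk t →
                  Σ Elem λ z → π (proj₁ z) ≡ lookup Γ k × Structure.pred structure z ≡ x ×
                               proj₁ z ≡ proj₁ x ∷ʳ (proj₁ c , t)
  child-of-sort {k} (i , σk≡ , refl) x πx≡ {t} m =
    z , trans (π-∷ʳ (proj₁ x) (i , t)) σi≡σk , Elem-≡ (dropLast-∷ʳ (proj₁ x) (i , t)) , refl
    where
    σi≡σk : π (proj₁ x) ∷ʳ i ≡ lookup Γ k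
    σi≡σk = trans (cong (_∷ʳ i) πx≡) (sym σk≡)
    z : Elem
    z = proj₁ x ∷ʳ (i , t) ,
        Valid-∷ʳ⁺ [] (proj₁ x) (i , t) (proj₂ x)
          (subst (_∈ Γ) (sym σi≡σk) (∈-lookup k) , subst (λ σ → Match (lab σ) t) (sym σi≡σk) m)

  ΓS⊨ax-one-child : structure ⊨ ax-one-child
  ΓS⊨ax-one-child = ΓS.⋀-intro _ λ k → ΓS.⋀-intro _ λ l → ΓS.when-intro em (has-child k l) λ c x Pl →
    let z , Pk , pred≡ , _ = child-of-sort c x Pl {nothing} tt in z , Pk , pred≡

  ΓS⊨ax-one-unique : structure ⊨ ax-one-unique
  ΓS⊨ax-one-unique = ΓS.⋀-intro _ λ k → ΓS.when-intro em (siblings-equal k) λ lab≡ y z (Py , Pz , pred≡) →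
    Elem-≡ (one-labelled-siblings (proj₂ y) (proj₂ z) (trans Py (sym Pz)) (trans (cong lab Py) lab≡)
                                  (cong proj₁ pred≡))

  code : S → ℕ
  code = Inverse.to e

  weight : Seq → ℕ
  weight []                  = 0
  weight ((_ , nothing) ∷ xs) = weight xs
  weight ((_ , just s)  ∷ xs) = code s + weight xs

  code≤weight : ∀ xs i s → code s ≤ weight (xs ∷ʳ (i , just s))
  code≤weight []                   i s = m≤m+n (code s) 0
  code≤weight ((_ , nothing) ∷ xs) i s = code≤weight xs i s
  code≤weight ((_ , just s′) ∷ xs) i s = ≤-trans (code≤weight xs i s) (m≤n+m _ (code s′))

  total-weight : ∀ {n} → (Fin n → Elem) → ℕ
  total-weight {zero}  v = 0
  total-weight {suc n} v = weight (proj₁ (v zero)) + total-weight (v ∘ suc)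

  weight≤total : ∀ {n} (v : Fin n → Elem) j → weight (proj₁ (v j)) ≤ total-weight v
  weight≤total v zero    = m≤m+n _ _
  weight≤total v (suc j) = ≤-trans (weight≤total (v ∘ suc) j) (m≤n+m _ _)

  -- the code of fresh v exceeds the code of every label occurring in v
  fresh : ∀ {n} → (Fin n → Elem) → S
  fresh v = Inverse.from e (suc (total-weight v))

  fresh-avoids : ∀ {n} (v : Fin n → Elem) xs i j → proj₁ (v j) ≢ xs ∷ʳ (i , just (fresh v))
  fresh-avoids v xs i j vj≡ = <⇒≱ (s≤s (weight≤total v j)) (begin
    suc (total-weight v)               ≡⟨ Inverse.strictlyInverseˡ e _ ⟨
    code (fresh v)                     ≤⟨ code≤weight xs i (fresh v) ⟩
    weight (xs ∷ʳ (i , just (fresh v))) ≡⟨ cong weight vj≡ ⟨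
    weight (proj₁ (v j))               ∎)
    where open ≤-Reasoning

  ΓS⊨ax-many-children : ∀ n → structure ⊨ ax-many-children n
  ΓS⊨ax-many-children n =
    ΓS.⋀-intro _ λ k → ΓS.⋀-intro _ λ l → ΓS.when-intro em (has-fresh-child n k l) λ c x Pl →
    ΓS.∀ⁿ-intro n _ λ v →
      let z , Pk , pred≡ , z≡ = child-of-sort c x Pl {just (fresh v)} tt in
      z , Pk , trans pred≡ (sym (ΓS.++ᵉ-↑ʳ v _ zero)) ,
      ΓS.⋀-intro _ λ j z≡vj →
        fresh-avoids v (proj₁ x) (proj₁ c) j (trans (cong proj₁ (sym (trans z≡vj (ΓS.++ᵉ-↑ˡ v _ j)))) z≡)

  module ModelOf (M : Structure TP) (M⊨ : ModelOfTh M structure) where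
    open Structure M renaming (_≤_ to _⊑_)
    module Mˢ = Semantics M

    ⋀-when-elim : ∀ {n} {ρ : Fin n → Carrier} {A : Fin (length Γ) → Set}
                  (φ : Fin (length Γ) → Formula TP n) →
                  Sat M ρ (⋀ λ k → when (em {A k}) (φ k)) → ∀ k → A k → Sat M ρ (φ k)
    ⋀-when-elim φ s k = Mˢ.when-elim em (φ k) (Mˢ.⋀-elim _ s k)

    ⋀⋀-when-elim : ∀ {n} {ρ : Fin n → Carrier} {A : Fin (length Γ) → Fin (length Γ) → Set}
                   (φ : Fin (length Γ) → Fin (length Γ) → Formula TP n) →
                   Sat M ρ (⋀ λ k → ⋀ λ l → when (em {A k l}) (φ k l)) → ∀ k l → A k l → Sat M ρ (φ k l)
    ⋀⋀-when-elim φ s k l = Mˢ.when-elim em (φ k l) (Mˢ.⋀-elim _ (Mˢ.⋀-elim _ s k) l)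

    order : ∀ x y → (x ⊑ y) ⇔ (∃ λ d → d ≤ depth × x ≡ iterate pred y d)
    order x y = mk⇔
      (λ x⊑y → let d , d≤ , x≡ = Mˢ.⋁≤-elim {b = depth} {ρ = ρ} below (⊑⇒below x⊑y) in
               d , d≤ , trans x≡ (Mˢ.eval-pred^ ρ d v₀))
      (λ (d , d≤ , x≡) → below⇒⊑ (Mˢ.⋁≤-intro below d≤ (trans x≡ (sym (Mˢ.eval-pred^ ρ d v₀)))))
      where
      ρ = extend M y (extend M x (λ ()))
      ⊑⇒below = proj₁ (M⊨ ax-order ΓS⊨ax-order x y)
      below⇒⊑ = proj₂ (M⊨ ax-order ΓS⊨ax-order x y)

    tree-axioms : TreeAxioms M
    tree-axioms = record
      { sort-exists    = λ x → Mˢ.⋁-elim _ (M⊨ ax-sort ΓS⊨ax-sort x)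
      ; sort-unique    = λ x {k} {l} Pk Pl → case k ≟ᶠ l of λ where
          (yes k≡l) → k≡l
          (no k≢l)  → ⊥-elim (⋀⋀-when-elim disjoint (M⊨ ax-sort-unique ΓS⊨ax-sort-unique x) k l k≢l
                                            (Pk , Pl))
      ; root-sort      = λ k σ≡[] → proj₁ (⋀-when-elim root-of-sort (M⊨ ax-root ΓS⊨ax-root) k σ≡[])
      ; root-unique    = λ k x σ≡[] → proj₂ (⋀-when-elim root-of-sort (M⊨ ax-root ΓS⊨ax-root) k σ≡[]) x
      ; pred-sort      = λ k l i x σ≡ →
          ⋀⋀-when-elim parent-of-sort (M⊨ ax-pred-sort ΓS⊨ax-pred-sort x) k l (i , σ≡)
      ; pred-ε         = M⊨ ax-pred-ε ΓS⊨ax-pred-ε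
      ; ≤⇔iterate-pred = order
      ; ⊓-glb          = M⊨ ax-meet ΓS⊨ax-meet
      }

    one-child : ∀ {k l} → ChildSort k l one → ∀ x → P l x → ∃ λ y → P k y × pred y ≡ x
    one-child {k} {l} = ⋀⋀-when-elim has-child (M⊨ ax-one-child ΓS⊨ax-one-child) k l

    one-unique : ∀ {k} → lab (lookup Γ k) ≡ one → ∀ {y z} → P k y → P k z → pred y ≡ pred z → y ≡ z
    one-unique {k} lab≡ Py Pz pred≡ =
      ⋀-when-elim siblings-equal (M⊨ ax-one-unique ΓS⊨ax-one-unique) k lab≡ _ _ (Py , Pz , pred≡)

    fresh-child : ∀ {k l} → ChildSort k l inf → ∀ {x} → P l x → ∀ {n} (v : Fin n → Carrier) →
                  ∃ λ z → P k z × pred z ≡ x × (∀ j → z ≢ v j)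
    fresh-child {k} {l} c {x} Pl {n} v
      with z , Pk , pred≡ , avoids ← Mˢ.∀ⁿ-elim n _
             (⋀⋀-when-elim (has-fresh-child n) (M⊨ (ax-many-children n) (ΓS⊨ax-many-children n)) k l c x Pl) v
      = z , Pk , trans pred≡ (Mˢ.++ᵉ-↑ʳ v _ zero) , λ j z≡vj → Mˢ.⋀-elim _ avoids j (trans z≡vj (sym (Mˢ.++ᵉ-↑ˡ v _ j)))

  module Countable (M : Structure TP) (M⊨ : ModelOfTh M structure) (M↔ℕ : Structure.Carrier M ↔ ℕ) where
    open Structure M hiding (_≤_)
    open ModelOf M M⊨

    encode : Carrier → ℕ
    encode = Inverse.to M↔ℕ

    decode : ℕ → Carrier
    decode = Inverse.from M↔ℕ

    decode-encode : ∀ x → decode (encode x) ≡ x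
    decode-encode = Inverse.strictlyInverseʳ M↔ℕ

    ChildCode : Fin (length Γ) → Carrier → ℕ → Set
    ChildCode k m n = P k (decode n) × pred (decode n) ≡ m

    child-code : ∀ {k m y} → P k y → pred y ≡ m → ChildCode k m (encode y)
    child-code {k} {y = y} Pk pred≡ = subst (P k) (sym (decode-encode y)) Pk , trans (cong pred (decode-encode y)) pred≡

    Unbounded : Fin (length Γ) → Carrier → Set
    Unbounded k m = ∀ b → ∃ λ n → b ≤ n × ChildCode k m n

    module Children {k m} (ub : Unbounded k m) = Enumeration {ChildCode k m} (λ _ → em) ub

    unbounded : ∀ {k l m} → ChildSort k l inf → P l m → Unbounded k m
    unbounded cs Pl b with z , Pk , pred≡ , avoids ← fresh-child cs Pl (λ (j : Fin b) → decode (toℕ j))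
      = encode z , ≮⇒≥ encode≮b , child-code Pk pred≡
      where
      encode≮b : ¬ encode z < b
      encode≮b lt = avoids (fromℕ< lt) (trans (sym (decode-encode z)) (cong decode (sym (toℕ-fromℕ< lt))))

    OneChild : List ℕ → Carrier → Set
    OneChild τ m = ∃ λ y → Over M τ y × pred y ≡ m

    ManyChildren : List ℕ → Carrier → Set
    ManyChildren τ m = ∃ λ k → lookup Γ k ≡ τ × Unbounded k m

    -- the fallback m is never used for an admissible step
    choose : List ℕ → Carrier → Maybe S → Carrier
    choose τ m nothing with em {OneChild τ m}
    ... | yes (y , _) = y
    ... | no  _       = m
    choose τ m (just s) with em {ManyChildren τ m}
    ... | yes (k , _ , ub) = decode (Children.enum ub (code s))
    ... | no  _            = m

    module _ {σ m i} (over : Over M σ m) (σi∈Γ : (σ ∷ʳ i) ∈ Γ) where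
      private
        τ = σ ∷ʳ i
        k = position σi∈Γ

      child-sort : ∀ {λk} → lab τ ≡ λk → ChildSort k (proj₁ over) λk
      child-sort refl = i , trans (lookup-position σi∈Γ) (cong (_∷ʳ i) (sym (proj₁ (proj₂ over)))) ,
                        cong lab (lookup-position σi∈Γ)

      choose-one-over : lab τ ≡ one → Over M τ (choose τ m nothing) × pred (choose τ m nothing) ≡ m
      choose-one-over lab≡ with em {OneChild τ m}
      ... | yes (_ , over′ , pred≡) = over′ , pred≡
      ... | no ¬one with y , Pk , pred≡ ← one-child (child-sort lab≡) m (proj₂ (proj₂ over))
        = ⊥-elim (¬one (y , (k , lookup-position σi∈Γ , Pk) , pred≡))

      many-children : lab τ ≡ inf → ManyChildren τ m
      many-children lab≡ = k , lookup-position σi∈Γ , unbounded (child-sort lab≡) (proj₂ (proj₂ over))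

      choose-inf-over : lab τ ≡ inf → ∀ s → Over M τ (choose τ m (just s)) × pred (choose τ m (just s)) ≡ m
      choose-inf-over lab≡ s with em {ManyChildren τ m}
      ... | yes (k′ , k′≡ , ub) = let Pk′ , pred≡ = Children.enum-∈ ub (code s) in (k′ , k′≡ , Pk′) , pred≡
      ... | no ¬many = ⊥-elim (¬many (many-children lab≡))

      choose-inf-injective : lab τ ≡ inf → ∀ {s s′} → choose τ m (just s) ≡ choose τ m (just s′) → s ≡ s′
      choose-inf-injective lab≡ eq with em {ManyChildren τ m}
      ... | yes (_ , _ , ub) =
        Injection.injective (↔⇒↣ e) (Children.enum-injective ub (Injection.injective (↔⇒↣ (↔-sym M↔ℕ)) eq))
      ... | no ¬many = ⊥-elim (¬many (many-children lab≡))

      choose-one-onto : lab τ ≡ one → ∀ {y} → Over M τ y → pred y ≡ m → choose τ m nothing ≡ y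
      choose-one-onto lab≡ {y} (k₂ , k₂≡ , Pk₂) pred≡ with em {OneChild τ m}
      ... | yes (y′ , (k₃ , k₃≡ , Pk₃) , pred′≡) with refl ← lookup-injective Γ-unique (trans k₃≡ (sym k₂≡)) =
        one-unique (trans (cong lab k₂≡) lab≡) Pk₃ Pk₂ (trans pred′≡ (sym pred≡))
      ... | no ¬one = ⊥-elim (¬one (y , (k₂ , k₂≡ , Pk₂) , pred≡))

      choose-inf-onto : lab τ ≡ inf → ∀ {y} → Over M τ y → pred y ≡ m → ∃ λ s → choose τ m (just s) ≡ y
      choose-inf-onto lab≡ {y} (k₂ , k₂≡ , Pk₂) pred≡ with em {ManyChildren τ m}
      ... | yes (k′ , k′≡ , ub) with refl ← lookup-injective Γ-unique (trans k₂≡ (sym k′≡))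
        with j , enum≡ ← Children.enum-surjective ub (child-code Pk₂ pred≡)
        = Inverse.from e j ,
          trans (cong (decode ∘ Children.enum ub) (Inverse.strictlyInverseˡ e j)) (trans (cong decode enum≡) (decode-encode y))
      ... | no ¬many = ⊥-elim (¬many (many-children lab≡))

    child-choice : ChildChoice M
    child-choice = record
      { child            = λ xs m i t → choose (π xs ∷ʳ i) m t
      ; child-over       = λ over (σi∈Γ , match) → case Match-cases match of λ where
          (inj₁ (lab≡ , refl))     → choose-one-over over σi∈Γ lab≡
          (inj₂ (lab≡ , s , refl)) → choose-inf-over over σi∈Γ lab≡ s
      ; child-injective  = λ over (σi∈Γ , match) (_ , match′) eq → case Match-cases match of λ where
          (inj₁ (lab≡ , refl))     → sym (Match-one lab≡ match′)
          (inj₂ (lab≡ , _ , refl)) → case Match-inf lab≡ match′ of λ where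
            (_ , refl) → cong just (choose-inf-injective over σi∈Γ lab≡ eq)
      ; child-surjective = λ {xs} {m} {i} over σi∈Γ over-y pred≡ → case lab-cases (lab (π xs ∷ʳ i)) of λ where
          (inj₁ lab≡) → nothing , (σi∈Γ , subst (λ l → Match l nothing) (sym lab≡) tt) ,
                        choose-one-onto over σi∈Γ lab≡ over-y pred≡
          (inj₂ lab≡) → let s , chosen≡ = choose-inf-onto over σi∈Γ lab≡ over-y pred≡ in
                        just s , (σi∈Γ , subst (λ l → Match l (just s)) (sym lab≡) tt) , chosen≡
      }
      where
      lab-cases : ∀ l → l ≡ one ⊎ l ≡ inf
      lab-cases one = inj₁ refl
      lab-cases inf = inj₂ refl

  countable-model-≅ : ∀ M → ModelOfTh M structure → Structure.Carrier M ↔ ℕ → Iso structure M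
  countable-model-≅ M M⊨ M↔ℕ = Reconstruct.≅ (ModelOf.tree-axioms M M⊨) (Countable.child-choice M M⊨ M↔ℕ)

  module Homogeneity {n n′} (a : Fin n → Elem) (b : Fin n′ → Elem)
                     (h : SubIso structure (Gen structure a) (Gen structure b)) where
    open SubIso h
    open Transposition (decEq-from-↔ℕ e)

    A : Elem → Set
    A = Gen structure a

    predᴱ : Elem → Elem
    predᴱ = Structure.pred structure

    Gen-pred : ∀ {x} → A x → A (predᴱ x)
    Gen-pred (t , eq) = pred' t , cong predᴱ eq

    Below : Seq → Set
    Below xs = xs ≡ [] ⊎ ∃ λ j → xs ≼ proj₁ (a j)

    Below-≼ : ∀ {xs ys} → xs ≼ ys → Below ys → Below xs
    Below-≼ xs≼ys (inj₁ refl)      = inj₁ (≼[]⇒≡[] xs≼ys)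
    Below-≼ xs≼ys (inj₂ (j , ys≼)) = inj₂ (j , ≼-trans xs≼ys ys≼)

    generated-below : ∀ t → Below (proj₁ (eval structure a t))
    generated-below (var j)    = inj₂ (j , ≼-refl _)
    generated-below ε'         = inj₁ refl
    generated-below (meet t u) = Below-≼ (lcp-≼ˡ _ _) (generated-below t)
    generated-below (pred' t)  = Below-≼ (dropLast-≼ _) (generated-below t)

    ancestors : List Elem
    ancestors = Structure.ε structure ∷
                cartesianProductWith (λ j d → iterate predᴱ (a j) d) (allFin n) (upTo (suc depth))

    Gen⊆ancestors : ∀ {x} → A x → x ∈ ancestors
    Gen⊆ancestors (t , refl) with generated-below t
    ... | inj₁ x≡[]       = here (Elem-≡ x≡[])
    ... | inj₂ (j , x≼aj) =
      let d , d≤ , x≡ = ≼⇒iterate-dropLast x≼aj in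
      there (subst (_∈ _) (Elem-≡ (trans (proj₁-iterate-pred (a j) d) (sym x≡)))
              (∈-cartesianProductWith⁺ _ (∈-allFin j) (∈-upTo⁺ (s≤s (≤-trans d≤ (depth-bound (a j)))))))

    fun-cong : ∀ {x y} p q → x ≡ y → fun x p ≡ fun y q
    fun-cong p q = Equivalence.from (wd-inj _ _ p q)

    π-fun : ∀ x p → π (proj₁ (fun x p)) ≡ π (proj₁ x)
    π-fun x p = trans (Equivalence.to (pres-P _ x p) (sym (lookup-position (π∈Γ x)))) (lookup-position (π∈Γ x))

    fun-child : ∀ c p {xs i t} → proj₁ c ≡ xs ∷ʳ (i , t) →
                ∃ λ t′ → Match (lab (π xs ∷ʳ i)) t′ ×
                         proj₁ (fun c p) ≡ proj₁ (fun (predᴱ c) (Gen-pred p)) ∷ʳ (i , t′)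
    fun-child c p {xs} {i} {t} c≡
      with ws , t′ , fun≡ , πws≡ ← ∷ʳ-shape (proj₁ (fun c p)) (trans (π-fun c p) (trans (cong π c≡) (π-∷ʳ xs (i , t))))
      = t′ , subst (λ σ → Match (lab (σ ∷ʳ i)) t′) πws≡ match′ , trans fun≡ (cong (_∷ʳ (i , t′)) ws≡)
      where
      match′ : Match (lab (π ws ∷ʳ i)) t′
      match′ = proj₂ (proj₂ (Valid-∷ʳ⁻ [] ws (i , t′) (subst (Valid []) fun≡ (proj₂ (fun c p)))))
      ws≡ : ws ≡ proj₁ (fun (predᴱ c) (Gen-pred p))
      ws≡ = trans (sym (dropLast-∷ʳ ws (i , t′)))
                  (trans (cong dropLast (sym fun≡)) (cong proj₁ (sym (pres-pred c p (Gen-pred p)))))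

    RelabelsAt : Seq → ℕ → Elem → S → S → Set
    RelabelsAt xs i c s s′ = Σ (A c) λ p →
      proj₁ c ≡ xs ∷ʳ (i , just s) × proj₁ (fun c p) ≡ proj₁ (fun (predᴱ c) (Gen-pred p)) ∷ʳ (i , just s′)

    Relabels : Seq → ℕ → S → S → Set
    Relabels xs i s s′ = ∃ λ c → RelabelsAt xs i c s s′

    last-label : ∀ {xs ys : Seq} {i j : ℕ} {s s′ : S} → xs ∷ʳ (i , just s) ≡ ys ∷ʳ (j , just s′) → s ≡ s′
    last-label {xs} {ys} eq = just-injective (cong proj₂ (∷ʳ-injectiveʳ xs ys eq))

    relabels-injective : ∀ {xs i s₁ s₁′ s₂ s₂′} → Relabels xs i s₁ s₁′ → Relabels xs i s₂ s₂′ →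
                         (s₁ ≡ s₂ → s₁′ ≡ s₂′) × (s₁′ ≡ s₂′ → s₁ ≡ s₂)
    relabels-injective {xs} {i} {s₁} {s₁′} {s₂} {s₂′} (c₁ , p₁ , c₁≡ , fun₁≡) (c₂ , p₂ , c₂≡ , fun₂≡) =
      forward , backward
      where
      parents≡ : fun (predᴱ c₁) (Gen-pred p₁) ≡ fun (predᴱ c₂) (Gen-pred p₂)
      parents≡ = fun-cong _ _ (Elem-≡ (trans (cong dropLast c₁≡)
                   (trans (dropLast-∷ʳ xs _) (sym (trans (cong dropLast c₂≡) (dropLast-∷ʳ xs _))))))
      forward : s₁ ≡ s₂ → s₁′ ≡ s₂′
      forward refl =
        last-label (trans (sym fun₁≡) (trans (cong proj₁ (fun-cong p₁ p₂ (Elem-≡ (trans c₁≡ (sym c₂≡))))) fun₂≡))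
      backward : s₁′ ≡ s₂′ → s₁ ≡ s₂
      backward refl = last-label (trans (sym c₁≡) (trans (cong proj₁ (Equivalence.to (wd-inj _ _ p₁ p₂) funs≡)) c₂≡))
        where
        funs≡ : fun c₁ p₁ ≡ fun c₂ p₂
        funs≡ = Elem-≡ (trans fun₁≡ (trans (cong (λ H → proj₁ H ∷ʳ (i , just _)) parents≡) (sym fun₂≡)))

    pair-at : Seq → ℕ → Elem → Maybe (S × S)
    pair-at xs i c with em {∃ λ s → ∃ λ s′ → RelabelsAt xs i c s s′}
    ... | yes (s , s′ , _) = just (s , s′)
    ... | no  _            = nothing

    pair-at-sound : ∀ {xs i c s s′} → pair-at xs i c ≡ just (s , s′) → Relabels xs i s s′
    pair-at-sound {xs} {i} {c} eq with em {∃ λ s → ∃ λ s′ → RelabelsAt xs i c s s′} | eq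
    ... | yes (s , s′ , r) | refl = c , r

    pair-at-complete : ∀ {xs i c s s′} → RelabelsAt xs i c s s′ → ∃ λ s″ → pair-at xs i c ≡ just (s , s″)
    pair-at-complete {xs} {i} {c} r@(_ , c≡ , _) with em {∃ λ s → ∃ λ s′ → RelabelsAt xs i c s s′}
    ... | yes (s₁ , s₁′ , _ , c≡₁ , _) = s₁′ , cong (λ s → just (s , s₁′)) (last-label (trans (sym c≡₁) c≡))
    ... | no ¬r = ⊥-elim (¬r (_ , _ , r))

    relabelling : Seq → ℕ → List (S × S)
    relabelling xs i = mapMaybe (pair-at xs i) ancestors

    relabelling-sound : ∀ {xs i s s′} → (s , s′) ∈ relabelling xs i → Relabels xs i s s′
    relabelling-sound {xs} {i} q∈ = let _ , _ , pair≡ = ∈-mapMaybe⁻ (pair-at xs i) ancestors q∈ in pair-at-sound pair≡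

    relabelling-complete : ∀ {xs i s s′} → Relabels xs i s s′ → ∃ λ s″ → (s , s″) ∈ relabelling xs i
    relabelling-complete {xs} {i} (c , r@(p , _)) =
      let s″ , pair≡ = pair-at-complete r in s″ , ∈-mapMaybe⁺ (pair-at xs i) (Gen⊆ancestors p) pair≡

    φ : Seq → ℕ → S ↔ S
    φ xs i = extension (relabelling xs i)

    φ-relabels : ∀ {xs i s s′} → Relabels xs i s s′ → Inverse.to (φ xs i) s ≡ s′
    φ-relabels r = let s″ , q∈ = relabelling-complete r in
      trans (extension-extends _ (λ q₁ q₂ → relabels-injective (relabelling-sound q₁) (relabelling-sound q₂)) q∈)
            (proj₁ (relabels-injective (relabelling-sound q∈) r) refl)

    relabel : Seq → ℕ → Maybe S → Maybe S
    relabel xs i = Maybe.map (Inverse.to (φ xs i))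

    relabel-injective : ∀ xs i {t t′} → relabel xs i t ≡ relabel xs i t′ → t ≡ t′
    relabel-injective xs i = map-injective (Injection.injective (↔⇒↣ (φ xs i)))

    relabel-onto : ∀ xs i t′ → relabel xs i (Maybe.map (Inverse.from (φ xs i)) t′) ≡ t′
    relabel-onto xs i t′ = trans (sym (map-∘ t′)) (trans (map-cong (Inverse.strictlyInverseˡ (φ xs i)) t′) (map-id t′))

    -- as in choose, the fallback m is never used for an admissible step
    graft : Seq → Elem → ℕ → Maybe S → Elem
    graft xs m i t with em {Valid [] (proj₁ m ∷ʳ (i , relabel xs i t))}
    ... | yes v = proj₁ m ∷ʳ (i , relabel xs i t) , v
    ... | no  _ = m

    graft-≡ : ∀ xs m i t → Valid [] (proj₁ m ∷ʳ (i , relabel xs i t)) →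
              proj₁ (graft xs m i t) ≡ proj₁ m ∷ʳ (i , relabel xs i t)
    graft-≡ xs m i t v with em {Valid [] (proj₁ m ∷ʳ (i , relabel xs i t))}
    ... | yes _  = refl
    ... | no ¬v  = ⊥-elim (¬v v)

    graft-admissible : ∀ xs m i t → Over structure (π xs) m → Admissible (π xs) (i , t) →
                       proj₁ (graft xs m i t) ≡ proj₁ m ∷ʳ (i , relabel xs i t)
    graft-admissible xs m i t over (σi∈Γ , match) = graft-≡ xs m i t
      (Valid-∷ʳ⁺ [] (proj₁ m) _ (proj₂ m)
        (subst (λ σ → Admissible σ (i , relabel xs i t)) (sym (Over-π (π xs) m over))
               (σi∈Γ , Match-map (Inverse.to (φ xs i)) match)))

    graft-over : ∀ {xs m i t} → Over structure (π xs) m → Admissible (π xs) (i , t) →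
                 Over structure (π xs ∷ʳ i) (graft xs m i t) × predᴱ (graft xs m i t) ≡ m
    graft-over {xs} {m} {i} {t} over adm@(σi∈Γ , _) =
      (position σi∈Γ , lookup-position σi∈Γ , (begin
        π (proj₁ (graft xs m i t))        ≡⟨ cong π graft≡ ⟩
        π (proj₁ m ∷ʳ (i , relabel xs i t)) ≡⟨ π-∷ʳ (proj₁ m) _ ⟩
        π (proj₁ m) ∷ʳ i                  ≡⟨ cong (_∷ʳ i) (Over-π (π xs) m over) ⟩
        π xs ∷ʳ i                         ≡⟨ lookup-position σi∈Γ ⟨
        lookup Γ (position σi∈Γ)          ∎)) ,
      Elem-≡ (trans (cong dropLast graft≡) (dropLast-∷ʳ (proj₁ m) _))
      where
      open ≡-Reasoning
      graft≡ = graft-admissible xs m i t over adm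

    graft-injective : ∀ {xs m i t t′} → Over structure (π xs) m → Admissible (π xs) (i , t) →
                      Admissible (π xs) (i , t′) → graft xs m i t ≡ graft xs m i t′ → t ≡ t′
    graft-injective {xs} {m} {i} {t} {t′} over adm adm′ eq =
      relabel-injective xs i (cong proj₂ (∷ʳ-injectiveʳ (proj₁ m) (proj₁ m)
        (trans (sym (graft-admissible xs m i t over adm)) (trans (cong proj₁ eq) (graft-admissible xs m i t′ over adm′)))))

    graft-onto : ∀ {xs m i y} → Over structure (π xs) m → (π xs ∷ʳ i) ∈ Γ → Over structure (π xs ∷ʳ i) y →
                 predᴱ y ≡ m → ∃ λ t → Admissible (π xs) (i , t) × graft xs m i t ≡ y
    graft-onto {xs} {m} {i} {y} over σi∈Γ over-y pred≡
      with ws , t′ , y≡ , πws≡ ← ∷ʳ-shape (proj₁ y) (Over-π (π xs ∷ʳ i) y over-y)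
      = t , adm , Elem-≡ (trans (graft-admissible xs m i t over adm)
                                (sym (trans y≡ (cong₂ (λ ws t → ws ∷ʳ (i , t)) ws≡ (sym (relabel-onto xs i t′))))))
      where
      t = Maybe.map (Inverse.from (φ xs i)) t′
      match′ : Match (lab (π ws ∷ʳ i)) t′
      match′ = proj₂ (proj₂ (Valid-∷ʳ⁻ [] ws (i , t′) (subst (Valid []) y≡ (proj₂ y))))
      adm : Admissible (π xs) (i , t)
      adm = σi∈Γ , Match-map (Inverse.from (φ xs i)) (subst (λ σ → Match (lab (σ ∷ʳ i)) t′) πws≡ match′)
      ws≡ : ws ≡ proj₁ m
      ws≡ = trans (sym (dropLast-∷ʳ ws (i , t′))) (trans (cong dropLast (sym y≡)) (cong proj₁ pred≡))

    child-choice : ChildChoice structure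
    child-choice = record
      { child            = graft
      ; child-over       = graft-over
      ; child-injective  = graft-injective
      ; child-surjective = graft-onto
      }

    open Reconstruct (ModelOf.tree-axioms structure (λ _ → id)) child-choice

    fun-last : ∀ xs i t v p (r : A (xs , proj₁ (Valid-∷ʳ⁻ [] xs (i , t) v))) →
               proj₁ (fun (xs ∷ʳ (i , t) , v) p) ≡ proj₁ (fun (xs , _) r) ∷ʳ (i , relabel xs i t)
    fun-last xs i t v p r with t′ , match′ , fun≡ ← fun-child (xs ∷ʳ (i , t) , v) p refl
      = trans fun≡ (cong₂ (λ H t → proj₁ H ∷ʳ (i , t)) (fun-cong _ r (Elem-≡ (dropLast-∷ʳ xs (i , t)))) t′≡)
      where
      t′≡ : t′ ≡ relabel xs i t
      t′≡ with Match-cases (proj₂ (proj₂ (Valid-∷ʳ⁻ [] xs (i , t) v)))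
      ... | inj₁ (lab≡ , refl)     = Match-one lab≡ match′
      ... | inj₂ (lab≡ , s , refl) with s′ , refl ← Match-inf lab≡ match′
        = cong just (sym (φ-relabels ((xs ∷ʳ (i , just s) , v) , p , refl , fun≡)))

    image-extends : ∀ xs v p → image xs ≡ fun (xs , v) p
    image-extends xs = go (reverseView xs)
      where
      go : ∀ {xs} → Reverse xs → ∀ v p → image xs ≡ fun (xs , v) p
      go []                    v p = sym (pres-ε p)
      go (xs ∶ r ∶ʳ (i , t)) v p =
        let v′ = proj₁ (Valid-∷ʳ⁻ [] xs (i , t) v)
            q  = subst A (Elem-≡ (dropLast-∷ʳ xs (i , t))) (Gen-pred p)
            last≡ = fun-last xs i t v p q
        in begin
          image (xs ∷ʳ (i , t))            ≡⟨ image-∷ʳ xs i t ⟩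
          graft xs (image xs) i t           ≡⟨ cong (λ m → graft xs m i t) (go r v′ q) ⟩
          graft xs (fun (xs , v′) q) i t    ≡⟨ Elem-≡ (trans (graft-≡ xs _ i t (subst (Valid []) last≡ (proj₂ (fun _ p))))
                                                             (sym last≡)) ⟩
          fun (xs ∷ʳ (i , t) , v) p         ∎
        where open ≡-Reasoning

    automorphism : Σ (Iso structure structure) λ g → ∀ x p → Iso.f g x ≡ fun x p
    automorphism = ≅ , λ x p → image-extends (proj₁ x) (proj₂ x) p

lemma2p1p7 : ExcludedMiddle 0ℓ → (TP : TreePlan) {S : Set} (e : S ↔ ℕ) →
    Ultrahomogeneous (Γ⟨ TP ⟩ e) × ℵ₀-categoricalTh (Γ⟨ TP ⟩ e)
lemma2p1p7 em TP e =
  (λ a b h → Homogeneity.automorphism a b h) ,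
  (λ M₁ M₂ M₁↔ℕ M₂↔ℕ M₁⊨ M₂⊨ →
     Iso-trans (Iso-sym (countable-model-≅ M₁ M₁⊨ M₁↔ℕ)) (countable-model-≅ M₂ M₂⊨ M₂↔ℕ))
  where open Theory em TP e
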